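{- The rule $\mathsf{i}{\downarrow}$, with instances $\emptyset\longrightarrow\overline A\sqcup A$ for arbitrary graphs $A$, is derivable in $\mathsf{SGS}{\downarrow}$; dually, the rule $\mathsf{i}{\uparrow}$, with instances $A\otimes\overline A\longrightarrow\emptyset$ for arbitrary graphs $A$, is derivable in $\mathsf{SGS}{\uparrow}$.
   Context: Atoms: a countable set $\mathcal V$ of variables and a disjoint copy $\overline{\mathcal V}$; atoms are elements of $\mathcal V\cup\overline{\mathcal V}$, with $\overline{\overline a}=a$. A graph is a finite simple undirected graph with vertices labelled by atoms, identified up to label-preserving isomorphism; $\emptyset$ is the empty graph; $a$ also denotes a one-vertex graph. $G\sqcup H$ is disjoint union; $G\otimes H$ is disjoint union plus all edges between $V_G$ and $V_H$. $\overline G$: same vertices, complementary edges, dual labels. A context is a graph $C$ with $R\subseteq V_C$; $C[M]_R$ is $C\sqcup M$ plus all edges between $V_M$ and $R$. A module of $G$ is an induced subgraph $M$ with every outside vertex adjacent to all or none of $M$; $P$ is prime if $|V_P|\ge2$ and its only modules are $\emptyset$, singletons and $P$. For $G$ with vertices $v_1,\dots,v_n$, $G\langle H_1,\dots,H_n\rangle$ replaces $v_i$ by $H_i$, keeps internal edges, joins $H_i$ to $H_j$ ($i\ne j$) iff $v_iv_j\in E_G$; $\overline G\langle\cdots\rangle$ uses the same vertex order. Rules: $\mathsf{ai}{\downarrow}$: $\emptyset\longrightarrow\overline a\sqcup a$; $\mathsf{ss}{\downarrow}$: $B[A]_S\longrightarrow B\sqcup A$, $S\subseteq V_B$, $S\ne\emptyset$,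 $A\ne\emptyset$; $\mathsf{p}{\downarrow}$: $(M_1\sqcup N_1)\otimes\cdots\otimes(M_n\sqcup N_n)\longrightarrow\overline P\langle M_1,\dots,M_n\rangle\sqcup P\langle N_1,\dots,N_n\rangle$, $P$ prime, $n=|V_P|\ge4$, all $M_i\ne\emptyset$; $\mathsf{ai}{\uparrow}$: $a\otimes\overline a\longrightarrow\emptyset$; $\mathsf{ss}{\uparrow}$: $B\otimes A\longrightarrow B[A]_S$, $S\subseteq V_B$, $S\ne V_B$, $A\ne\emptyset$; $\mathsf{p}{\uparrow}$: $P\langle M_1,\dots,M_n\rangle\otimes\overline P\langle N_1,\dots,N_n\rangle\longrightarrow(M_1\otimes N_1)\sqcup\cdots\sqcup(M_n\otimes N_n)$, $P$ prime, $n=|V_P|\ge4$, all $M_i\ne\emptyset$. $\mathsf{SGS}{\downarrow}=\{\mathsf{ai}{\downarrow},\mathsf{ss}{\downarrow},\mathsf{p}{\downarrow}\}$, $\mathsf{SGS}{\uparrow}=\{\mathsf{ai}{\uparrow},\mathsf{ss}{\uparrow},\mathsf{p}{\uparrow}\}$. A derivation in $\mathsf S$ from $X$ to $Y$ is a finite sequence of graphs each step of which is a label-preserving isomorphism or replaces $C[X']_R$ by $C[Y']_R$ for a context and an instance $X'\longrightarrow Y'$ of a rule of $\mathsf S$. A rule $\mathsf r$ is derivable in $\mathsf S$ if for every instance $X\longrightarrow Y$ of $\mathsf r$ there is a derivation in $\mathsf S$ from $X$ to $Y$. -}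

module Defs where

open import Data.Nat using (ℕ; zero; suc; _+_; _≤_; _<_)
open import Data.Bool using (Bool; true; false; _∨_; _∧_; not; if_then_else_)
open import Data.Fin using (Fin; zero; suc; splitAt; _≟_)
open import Data.Sum using (_⊎_; inj₁; inj₂)
open import Data.Product using (Σ; _×_; _,_; ∃)
open import Relation.Nullary.Decidable using (⌊_⌋; yes; no)
open import Relation.Binary.PropositionalEquality using (_≡_; refl)
open import Function.Bundles using (_↔_; Inverse)

-- Atoms: variables are ℕ (a countable set); (v , false) is the variable v,
-- (v , true) is its dual copy v̄.

Atom : Set
Atom = ℕ × Bool

dualAtom : Atom → Atom
dualAtom (v , b) = (v , not b)

-- A graph is given by a number of vertices, a
-- labelling and a *raw* Boolean relation `rel`; the actual (simple,
-- undirected) edge relation is `E`, the symmetric closure of `rel` with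
-- loops removed.  All notions below (isomorphism, modules, primality,
-- complement, ...) refer only to `E`, so every value of `Graph` denotes a
-- finite simple undirected atom-labelled graph, and every such graph is
-- denoted by some value.

record Graph : Set where
  constructor mkGraph
  field
    n   : ℕ
    lab : Fin n → Atom
    rel : Fin n → Fin n → Bool
open Graph public

E : (G : Graph) → Fin (n G) → Fin (n G) → Bool
E G i j = (rel G i j ∨ rel G j i) ∧ not ⌊ i ≟ j ⌋

record _≅_ (G H : Graph) : Set where
  field
    bij     : Fin (n G) ↔ Fin (n H)
    lab-pres : ∀ i → lab H (Inverse.to bij i) ≡ lab G i
    E-pres   : ∀ i j → E H (Inverse.to bij i) (Inverse.to bij j) ≡ E G i j

∅ : Graph
∅ = mkGraph 0 (λ ()) (λ ())

single : Atom → Graph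
single a = mkGraph 1 (λ _ → a) (λ _ _ → false)

glue : (G H : Graph) → (Fin (n G) → Fin (n H) → Bool) → Graph
glue G H f = mkGraph (n G + n H) lab' rel'
  where
  lab' : Fin (n G + n H) → Atom
  lab' x with splitAt (n G) x
  ... | inj₁ i = lab G i
  ... | inj₂ j = lab H j
  rel' : Fin (n G + n H) → Fin (n G + n H) → Bool
  rel' x y with splitAt (n G) x | splitAt (n G) y
  ... | inj₁ i | inj₁ i' = E G i i'
  ... | inj₂ j | inj₂ j' = E H j j'
  ... | inj₁ i | inj₂ j  = f i j
  ... | inj₂ _ | inj₁ _  = false

infixr 6 _⊔_
infixr 7 _⊗_

_⊔_ : Graph → Graph → Graph
G ⊔ H = glue G H (λ _ _ → false)

_⊗_ : Graph → Graph → Graph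
G ⊗ H = glue G H (λ _ _ → true)

dualG : Graph → Graph
dualG G = mkGraph (n G) (λ i → dualAtom (lab G i)) (λ i j → not (E G i j))

-- context plugging  C[M]_R  (R ⊆ V_C given as a Boolean predicate)
plug : (C : Graph) → Graph → (Fin (n C) → Bool) → Graph
plug C M R = glue C M (λ i _ → R i)

total : (m : ℕ) → (Fin m → ℕ) → ℕ
total zero    s = 0
total (suc m) s = s zero + total m (λ i → s (suc i))

decode : (m : ℕ) (s : Fin m → ℕ) → Fin (total m s) → Σ (Fin m) (λ i → Fin (s i))
decode zero    s ()
decode (suc m) s x with splitAt (s zero) x
... | inj₁ k = zero , k
... | inj₂ r with decode m (λ i → s (suc i)) r
...   | i , k = suc i , k

subst : (G : Graph) → (Fin (n G) → Graph) → Graph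
subst G H = mkGraph (total (n G) sz) lab' rel'
  where
  sz : Fin (n G) → ℕ
  sz i = n (H i)
  lab' : Fin (total (n G) sz) → Atom
  lab' x with decode (n G) sz x
  ... | i , k = lab (H i) k
  blockE : Σ (Fin (n G)) (λ i → Fin (sz i)) → Σ (Fin (n G)) (λ i → Fin (sz i)) → Bool
  blockE (i , k) (j , l) with i ≟ j
  ... | yes refl = E (H i) k l
  ... | no _     = E G i j
  rel' : Fin (total (n G) sz) → Fin (total (n G) sz) → Bool
  rel' x y = blockE (decode (n G) sz x) (decode (n G) sz y)

bigTensor : (m : ℕ) → (Fin m → Graph) → Graph
bigTensor zero    G = ∅
bigTensor (suc m) G = G zero ⊗ bigTensor m (λ i → G (suc i))

bigPar : (m : ℕ) → (Fin m → Graph) → Graph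
bigPar zero    G = ∅
bigPar (suc m) G = G zero ⊔ bigPar m (λ i → G (suc i))

IsModule : (G : Graph) → (Fin (n G) → Bool) → Set
IsModule G M = ∀ v x y → M v ≡ false → M x ≡ true → M y ≡ true → E G v x ≡ E G v y

Prime : Graph → Set
Prime P = 2 ≤ n P ×
  (∀ M → IsModule P M →
     (∀ x y → M x ≡ true → M y ≡ true → x ≡ y)
     ⊎ (∀ v → M v ≡ true))

NonEmpty : Graph → Set
NonEmpty G = 0 < n G

RuleSet : Set₁
RuleSet = Graph → Graph → Set

data ai↓ : RuleSet where
  inst : ∀ a → ai↓ ∅ (single (dualAtom a) ⊔ single a)

data ss↓ : RuleSet where
  inst : ∀ B A (S : Fin (n B) → Bool) → (∃ λ i → S i ≡ true) → NonEmpty A →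
         ss↓ (plug B A S) (B ⊔ A)

data p↓ : RuleSet where
  inst : ∀ P → Prime P → 4 ≤ n P → (M N : Fin (n P) → Graph) →
         (∀ i → NonEmpty (M i)) →
         p↓ (bigTensor (n P) (λ i → M i ⊔ N i)) (subst (dualG P) M ⊔ subst P N)

data ai↑ : RuleSet where
  inst : ∀ a → ai↑ (single a ⊗ single (dualAtom a)) ∅

data ss↑ : RuleSet where
  inst : ∀ B A (S : Fin (n B) → Bool) → (∃ λ i → S i ≡ false) → NonEmpty A →
         ss↑ (B ⊗ A) (plug B A S)

data p↑ : RuleSet where
  inst : ∀ P → Prime P → 4 ≤ n P → (M N : Fin (n P) → Graph) →
         (∀ i → NonEmpty (M i)) →
         p↑ (subst P M ⊗ subst (dualG P) N) (bigPar (n P) (λ i → M i ⊗ N i))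

_∪_ : RuleSet → RuleSet → RuleSet
(r ∪ s) X Y = r X Y ⊎ s X Y

SGS↓ : RuleSet
SGS↓ = ai↓ ∪ (ss↓ ∪ p↓)

SGS↑ : RuleSet
SGS↑ = ai↑ ∪ (ss↑ ∪ p↑)

data Derivation (S : RuleSet) : Graph → Graph → Set where
  done : ∀ {G} → Derivation S G G
  iso  : ∀ {G G' K} → G ≅ G' → Derivation S G' K → Derivation S G K
  rule : ∀ {X Y K} (C : Graph) (R : Fin (n C) → Bool) → S X Y →
         Derivation S (plug C Y R) K → Derivation S (plug C X R) K

Derivable : RuleSet → RuleSet → Set
Derivable r S = ∀ X Y → r X Y → Derivation S X Y

data i↓ : RuleSet where
  inst : ∀ A → i↓ ∅ (dualG A ⊔ A)

data i↑ : RuleSet where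
  inst : ∀ A → i↑ (A ⊗ dualG A) ∅

-- The identity rule is reduced to the following generalisation of p↓ to an arbitrary graph A
-- (GeneralisedP↓ A): (M₁ ⊔ N₁) ⊗ ⋯ ⊗ (Mₙ ⊔ Nₙ) ⟶ Ā⟨M₁,…,Mₙ⟩ ⊔ A⟨N₁,…,Nₙ⟩ whenever all Mᵢ are nonempty.
-- It is proved by induction on the number of vertices of A. If A has a module X with at least two
-- vertices but not all of them, then A⟨M⟩ = Q⟨A|X⟨M|X⟩, M outside X⟩ for the quotient Q that
-- collapses X to one vertex; the instance for A|X, applied inside the tensor, followed by the instance
-- for Q gives the instance for A. Otherwise A has at most two vertices, and at most two ss↓ steps
-- suffice, or A is prime with at least four vertices (no graph on three vertices is prime), and a single
-- p↓ step suffices. Taking Mᵢ = āᵢ and Nᵢ = aᵢ, the premise is derived from ∅ by ai↓, which gives i↓.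
-- Dualising every step of an SGS↓ derivation yields an SGS↑ derivation between the dual graphs in the
-- opposite direction, which gives i↑.
--
-- Isomorphisms are handled on structures with arbitrary decidable vertex types, where glueing
-- becomes ⊎ and substitution becomes Σ, instead of on the Fin-indexed graphs themselves.

module Submission where

open import Defs
open import Data.Bool as Bool using (Bool; true; false; _∨_; _∧_; not)
import Data.Bool.Properties as Boolₚ
open import Data.Empty using (⊥; ⊥-elim)
open import Data.Fin using (Fin; zero; suc; splitAt; join; _↑ˡ_; _↑ʳ_; _≟_)
import Data.Fin.Properties as Finₚ
open import Data.Fin.Subset.Properties using (anySubset?)
open import Data.Nat using (ℕ; zero; suc; _+_; _≤_; _<_; z≤n; s≤s)
import Data.Nat.Properties as ℕₚ
open import Data.Product using (Σ; _×_; _,_; proj₁; proj₂; ∃)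
import Data.Product.Properties as Productₚ
open import Data.Sum as Sum using (_⊎_; inj₁; inj₂; [_,_]′)
import Data.Sum.Properties as Sumₚ
import Data.Vec as Vec
import Data.Vec.Properties as Vecₚ
open import Function using (_∘_)
open import Function.Bundles using (Inverse; mk↔ₛ′; mk⇔)
open import Relation.Binary.Definitions using (DecidableEquality)
open import Relation.Binary.PropositionalEquality using (_≡_; _≢_; refl; sym; trans; cong; cong₂) renaming (subst to transport)
open import Relation.Nullary using (¬_; ¬?; Dec; yes; no; map′; _×-dec_; _→-dec_)
open import Relation.Nullary.Decidable using (⌊_⌋; does-⇔; dec-true; dec-false; isYes≗does; decidable-stable)
import Axiom.UniquenessOfIdentityProofs as UIP

⌊⌋-true : ∀ {A : Set} (a? : Dec A) → A → ⌊ a? ⌋ ≡ true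
⌊⌋-true a? a = trans (isYes≗does a?) (dec-true a? a)

⌊⌋-false : ∀ {A : Set} (a? : Dec A) → ¬ A → ⌊ a? ⌋ ≡ false
⌊⌋-false a? ¬a = trans (isYes≗does a?) (dec-false a? ¬a)

⌊⌋-⇔ : ∀ {A B : Set} (a? : Dec A) (b? : Dec B) → (A → B) → (B → A) → ⌊ a? ⌋ ≡ ⌊ b? ⌋
⌊⌋-⇔ a? b? f g = trans (isYes≗does a?) (trans (does-⇔ (mk⇔ f g) a? b?) (sym (isYes≗does b?)))

⌊⌋-injective : ∀ {A B : Set} (_≟ᴬ_ : DecidableEquality A) (_≟ᴮ_ : DecidableEquality B)
  (f : A → B) (g : B → A) → (∀ x → g (f x) ≡ x) → ∀ x y → ⌊ f x ≟ᴮ f y ⌋ ≡ ⌊ x ≟ᴬ y ⌋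
⌊⌋-injective _≟ᴬ_ _≟ᴮ_ f g g∘f x y =
  ⌊⌋-⇔ (f x ≟ᴮ f y) (x ≟ᴬ y) (λ p → trans (sym (g∘f x)) (trans (cong g p) (g∘f y))) (cong f)

true≢false : true ≢ false
true≢false ()

Fin-irrelevant : ∀ {m} {i j : Fin m} (p q : i ≡ j) → p ≡ q
Fin-irrelevant = UIP.Decidable⇒UIP.≡-irrelevant _≟_

Bool-irrelevant : ∀ {b c : Bool} (p q : b ≡ c) → p ≡ q
Bool-irrelevant = UIP.Decidable⇒UIP.≡-irrelevant Bool._≟_

record Structure : Set₁ where
  constructor structure
  field
    Vertex : Set
    decEq  : DecidableEquality Vertex
    label  : Vertex → Atom
    adj    : Vertex → Vertex → Bool
open Structure

infix 3 _≃_
infixr 4 _⨾_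

record _≃_ (A B : Structure) : Set where
  field
    to         : Vertex A → Vertex B
    from       : Vertex B → Vertex A
    from∘to    : ∀ x → from (to x) ≡ x
    to∘from    : ∀ y → to (from y) ≡ y
    label-pres : ∀ x → label B (to x) ≡ label A x
    adj-pres   : ∀ x y → adj B (to x) (to y) ≡ adj A x y
open _≃_

≃-refl : ∀ {A} → A ≃ A
≃-refl = record { to = λ x → x ; from = λ x → x ; from∘to = λ _ → refl ; to∘from = λ _ → refl
  ; label-pres = λ _ → refl ; adj-pres = λ _ _ → refl }

≃-sym : ∀ {A B} → A ≃ B → B ≃ A
≃-sym {A} {B} α = record { to = from α ; from = to α ; from∘to = to∘from α ; to∘from = from∘to α
  ; label-pres = λ y → trans (sym (label-pres α (from α y))) (cong (label B) (to∘from α y))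
  ; adj-pres = λ x y → trans (sym (adj-pres α (from α x) (from α y))) (cong₂ (adj B) (to∘from α x) (to∘from α y)) }

_⨾_ : ∀ {A B C} → A ≃ B → B ≃ C → A ≃ C
α ⨾ β = record { to = λ x → to β (to α x) ; from = λ z → from α (from β z)
  ; from∘to = λ x → trans (cong (from α) (from∘to β (to α x))) (from∘to α x)
  ; to∘from = λ z → trans (cong (to β) (to∘from α (from β z))) (to∘from β z)
  ; label-pres = λ x → trans (label-pres β (to α x)) (label-pres α x)
  ; adj-pres = λ x y → trans (adj-pres β (to α x) (to α y)) (adj-pres α x y) }

⟦_⟧ : Graph → Structure
⟦ G ⟧ = structure (Fin (n G)) _≟_ (lab G) (E G)

≃⇒≅ : ∀ {G H} → ⟦ G ⟧ ≃ ⟦ H ⟧ → G ≅ H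
≃⇒≅ α = record { bij = mk↔ₛ′ (to α) (from α) (to∘from α) (from∘to α)
  ; lab-pres = label-pres α ; E-pres = adj-pres α }

≅⇒≃ : ∀ {G H} → G ≅ H → ⟦ G ⟧ ≃ ⟦ H ⟧
≅⇒≃ φ = record { to = Inverse.to (_≅_.bij φ) ; from = Inverse.from (_≅_.bij φ)
  ; from∘to = Inverse.strictlyInverseʳ (_≅_.bij φ) ; to∘from = Inverse.strictlyInverseˡ (_≅_.bij φ)
  ; label-pres = _≅_.lab-pres φ ; adj-pres = _≅_.E-pres φ }

IsSimple : Structure → Set
IsSimple S = (∀ x y → adj S x y ≡ adj S y x) × (∀ x → adj S x x ≡ false)

closure-of-simple : ∀ S → IsSimple S → ∀ x y → (adj S x y ∨ adj S y x) ∧ not ⌊ decEq S x y ⌋ ≡ adj S x y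
closure-of-simple S (sym-adj , irrefl-adj) x y with decEq S x y
... | yes refl rewrite irrefl-adj x = refl
... | no _ rewrite sym-adj y x | Boolₚ.∨-idem (adj S x y) = Boolₚ.∧-identityʳ (adj S x y)

E-sym : ∀ G i j → E G i j ≡ E G j i
E-sym G i j = cong₂ (λ a b → a ∧ not b) (Boolₚ.∨-comm (rel G i j) (rel G j i)) (⌊⌋-⇔ (i ≟ j) (j ≟ i) sym sym)

E-irrefl : ∀ G i → E G i i ≡ false
E-irrefl G i rewrite ⌊⌋-true (i ≟ i) refl = Boolₚ.∧-zeroʳ (rel G i i ∨ rel G i i)

⟦⟧-simple : ∀ G → IsSimple ⟦ G ⟧
⟦⟧-simple G = E-sym G , E-irrefl G

glueAdj : (A B : Structure) → (Vertex A → Vertex B → Bool) → Vertex A ⊎ Vertex B → Vertex A ⊎ Vertex B → Bool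
glueAdj A B f (inj₁ a) (inj₁ a′) = adj A a a′
glueAdj A B f (inj₂ b) (inj₂ b′) = adj B b b′
glueAdj A B f (inj₁ a) (inj₂ b)  = f a b
glueAdj A B f (inj₂ b) (inj₁ a)  = f a b

glueˢ : (A B : Structure) → (Vertex A → Vertex B → Bool) → Structure
glueˢ A B f = structure (Vertex A ⊎ Vertex B) (Sumₚ.≡-dec (decEq A) (decEq B)) [ label A , label B ]′ (glueAdj A B f)

glueˢ-simple : ∀ A B f → IsSimple A → IsSimple B → IsSimple (glueˢ A B f)
glueˢ-simple A B f (symA , irreflA) (symB , irreflB) = sym-adj , irrefl-adj
  where
  sym-adj : ∀ x y → glueAdj A B f x y ≡ glueAdj A B f y x
  sym-adj (inj₁ a) (inj₁ a′) = symA a a′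
  sym-adj (inj₂ b) (inj₂ b′) = symB b b′
  sym-adj (inj₁ a) (inj₂ b)  = refl
  sym-adj (inj₂ b) (inj₁ a)  = refl
  irrefl-adj : ∀ x → glueAdj A B f x x ≡ false
  irrefl-adj (inj₁ a) = irreflA a
  irrefl-adj (inj₂ b) = irreflB b

glue-≃ : ∀ G H f → ⟦ glue G H f ⟧ ≃ glueˢ ⟦ G ⟧ ⟦ H ⟧ f
glue-≃ G H f = record { to = splitAt (n G) ; from = join (n G) (n H)
  ; from∘to = Finₚ.join-splitAt (n G) (n H) ; to∘from = Finₚ.splitAt-join (n G) (n H)
  ; label-pres = label-pres′ ; adj-pres = adj-pres′ }
  where
  S : Structure
  S = glueˢ ⟦ G ⟧ ⟦ H ⟧ f
  label-pres′ : ∀ x → label S (splitAt (n G) x) ≡ lab (glue G H f) x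
  label-pres′ x with splitAt (n G) x
  ... | inj₁ _ = refl
  ... | inj₂ _ = refl
  -- `rel` of `glue` only records the cross edges from G to H; `E` adds the reverse ones.
  oriented : Vertex S → Vertex S → Bool
  oriented (inj₂ _) (inj₁ _) = false
  oriented u v = glueAdj ⟦ G ⟧ ⟦ H ⟧ f u v
  rel-join : ∀ u v → rel (glue G H f) (join (n G) (n H) u) (join (n G) (n H) v) ≡ oriented u v
  rel-join u v rewrite Finₚ.splitAt-join (n G) (n H) u | Finₚ.splitAt-join (n G) (n H) v with u | v
  ... | inj₁ _ | inj₁ _ = refl
  ... | inj₂ _ | inj₂ _ = refl
  ... | inj₁ _ | inj₂ _ = refl
  ... | inj₂ _ | inj₁ _ = refl
  oriented-closure : ∀ u v → oriented u v ∨ oriented v u ≡ adj S u v ∨ adj S v u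
  oriented-closure (inj₁ _) (inj₁ _) = refl
  oriented-closure (inj₂ _) (inj₂ _) = refl
  oriented-closure (inj₁ i) (inj₂ j) = trans (Boolₚ.∨-identityʳ (f i j)) (sym (Boolₚ.∨-idem (f i j)))
  oriented-closure (inj₂ j) (inj₁ i) = sym (Boolₚ.∨-idem (f i j))
  E-join : ∀ u v → E (glue G H f) (join (n G) (n H) u) (join (n G) (n H) v) ≡ adj S u v
  E-join u v rewrite rel-join u v | rel-join v u | oriented-closure u v
     | ⌊⌋-injective (decEq S) _≟_ (join (n G) (n H)) (splitAt (n G)) (Finₚ.splitAt-join (n G) (n H)) u v
     = closure-of-simple S (glueˢ-simple _ _ f (⟦⟧-simple G) (⟦⟧-simple H)) u v
  adj-pres′ : ∀ x y → adj S (splitAt (n G) x) (splitAt (n G) y) ≡ E (glue G H f) x y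
  adj-pres′ x y = trans (sym (E-join (splitAt (n G) x) (splitAt (n G) y)))
                        (cong₂ (E (glue G H f)) (Finₚ.join-splitAt (n G) (n H) x) (Finₚ.join-splitAt (n G) (n H) y))

substAdj : ∀ {m} (e : Fin m → Fin m → Bool) (H : Fin m → Structure) →
           Σ (Fin m) (Vertex ∘ H) → Σ (Fin m) (Vertex ∘ H) → Bool
substAdj e H (i , v) (j , w) with i ≟ j
... | yes refl = adj (H i) v w
... | no _     = e i j

substˢ : (m : ℕ) → (Fin m → Fin m → Bool) → (Fin m → Structure) → Structure
substˢ m e H = structure (Σ (Fin m) (Vertex ∘ H)) (Productₚ.≡-dec _≟_ (λ {i} → decEq (H i)))
                 (λ (i , v) → label (H i) v) (substAdj e H)

substAdj-same : ∀ {m} e H (i : Fin m) v w → substAdj e H (i , v) (i , w) ≡ adj (H i) v w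
substAdj-same e H i v w with i ≟ i
... | yes p rewrite Fin-irrelevant p refl = refl
... | no i≢i = ⊥-elim (i≢i refl)

substAdj-diff : ∀ {m} e H (i j : Fin m) v w → i ≢ j → substAdj e H (i , v) (j , w) ≡ e i j
substAdj-diff e H i j v w i≢j with i ≟ j
... | yes i≡j = ⊥-elim (i≢j i≡j)
... | no _    = refl

substˢ-simple : ∀ m e H → (∀ i j → e i j ≡ e j i) → (∀ i → IsSimple (H i)) → IsSimple (substˢ m e H)
substˢ-simple m e H sym-e simple = sym-adj , irrefl-adj
  where
  sym-adj : ∀ x y → substAdj e H x y ≡ substAdj e H y x
  sym-adj (i , v) (j , w) with i ≟ j
  ... | yes refl = trans (proj₁ (simple i) v w) (sym (substAdj-same e H i w v))
  ... | no i≢j   = trans (sym-e i j) (sym (substAdj-diff e H j i w v (i≢j ∘ sym)))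
  irrefl-adj : ∀ x → substAdj e H x x ≡ false
  irrefl-adj (i , v) = trans (substAdj-same e H i v v) (proj₂ (simple i) v)

encode : (m : ℕ) (s : Fin m → ℕ) → Σ (Fin m) (Fin ∘ s) → Fin (total m s)
encode (suc m) s (zero , k)  = k ↑ˡ total m (s ∘ suc)
encode (suc m) s (suc i , k) = s zero ↑ʳ encode m (s ∘ suc) (i , k)

decode∘encode : ∀ m s p → decode m s (encode m s p) ≡ p
decode∘encode (suc m) s (zero , k) rewrite Finₚ.splitAt-↑ˡ (s zero) k (total m (s ∘ suc)) = refl
decode∘encode (suc m) s (suc i , k)
  rewrite Finₚ.splitAt-↑ʳ (s zero) (total m (s ∘ suc)) (encode m (s ∘ suc) (i , k))
        | decode∘encode m (s ∘ suc) (i , k) = refl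

encode∘decode : ∀ m s x → encode m s (decode m s x) ≡ x
encode∘decode (suc m) s x with splitAt (s zero) x in eq
... | inj₁ k = Finₚ.splitAt⁻¹-↑ˡ eq
... | inj₂ r with decode m (s ∘ suc) r in eq′
...   | i , k = trans (cong (s zero ↑ʳ_) (trans (cong (encode m (s ∘ suc)) (sym eq′)) (encode∘decode m (s ∘ suc) r)))
                      (Finₚ.splitAt⁻¹-↑ʳ eq)

subst-≃ : ∀ G H → ⟦ subst G H ⟧ ≃ substˢ (n G) (E G) (⟦_⟧ ∘ H)
subst-≃ G H = record { to = decode (n G) size ; from = encode (n G) size
  ; from∘to = encode∘decode (n G) size ; to∘from = decode∘encode (n G) size
  ; label-pres = label-pres′ ; adj-pres = adj-pres′ }
  where
  size : Fin (n G) → ℕ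
  size i = n (H i)
  S : Structure
  S = substˢ (n G) (E G) (⟦_⟧ ∘ H)
  label-pres′ : ∀ x → label S (decode (n G) size x) ≡ lab (subst G H) x
  label-pres′ x with decode (n G) size x
  ... | i , k = refl
  rel-encode : ∀ p q → rel (subst G H) (encode (n G) size p) (encode (n G) size q) ≡ adj S p q
  rel-encode p q rewrite decode∘encode (n G) size p | decode∘encode (n G) size q with p | q
  ... | (i , k) | (j , l) with i ≟ j
  ... | yes refl = refl
  ... | no _ = refl
  E-encode : ∀ p q → E (subst G H) (encode (n G) size p) (encode (n G) size q) ≡ adj S p q
  E-encode p q rewrite rel-encode p q | rel-encode q p
     | ⌊⌋-injective (decEq S) _≟_ (encode (n G) size) (decode (n G) size) (decode∘encode (n G) size) p q
     = closure-of-simple S (substˢ-simple _ _ _ (E-sym G) (⟦⟧-simple ∘ H)) p q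
  adj-pres′ : ∀ x y → adj S (decode (n G) size x) (decode (n G) size y) ≡ E (subst G H) x y
  adj-pres′ x y = trans (sym (E-encode (decode (n G) size x) (decode (n G) size y)))
                        (cong₂ (E (subst G H)) (encode∘decode (n G) size x) (encode∘decode (n G) size y))

glueˢ-cong : ∀ {A A′ B B′} (α : A ≃ A′) (β : B ≃ B′) (f : Vertex A → Vertex B → Bool) (f′ : Vertex A′ → Vertex B′ → Bool) →
             (∀ a b → f′ (to α a) (to β b) ≡ f a b) → glueˢ A B f ≃ glueˢ A′ B′ f′
glueˢ-cong α β f f′ f-pres = record { to = Sum.map (to α) (to β) ; from = Sum.map (from α) (from β)
  ; from∘to = λ { (inj₁ a) → cong inj₁ (from∘to α a) ; (inj₂ b) → cong inj₂ (from∘to β b) }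
  ; to∘from = λ { (inj₁ a) → cong inj₁ (to∘from α a) ; (inj₂ b) → cong inj₂ (to∘from β b) }
  ; label-pres = λ { (inj₁ a) → label-pres α a ; (inj₂ b) → label-pres β b }
  ; adj-pres = λ { (inj₁ a) (inj₁ a′) → adj-pres α a a′ ; (inj₂ b) (inj₂ b′) → adj-pres β b b′
                 ; (inj₁ a) (inj₂ b) → f-pres a b ; (inj₂ b) (inj₁ a) → f-pres a b } }

glueˢ-swap : ∀ A B f → glueˢ A B f ≃ glueˢ B A (λ b a → f a b)
glueˢ-swap A B f = record { to = Sum.swap ; from = Sum.swap
  ; from∘to = λ { (inj₁ _) → refl ; (inj₂ _) → refl }
  ; to∘from = λ { (inj₁ _) → refl ; (inj₂ _) → refl }
  ; label-pres = λ { (inj₁ _) → refl ; (inj₂ _) → refl }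
  ; adj-pres = λ { (inj₁ _) (inj₁ _) → refl ; (inj₂ _) (inj₂ _) → refl
                 ; (inj₁ _) (inj₂ _) → refl ; (inj₂ _) (inj₁ _) → refl } }

glueˢ-assoc : ∀ A B C (g : Vertex B → Vertex C → Bool) (h : Vertex A → Vertex B ⊎ Vertex C → Bool)
  (k : Vertex A ⊎ Vertex B → Vertex C → Bool) →
  (∀ a c → k (inj₁ a) c ≡ h a (inj₂ c)) → (∀ b c → k (inj₂ b) c ≡ g b c) →
  glueˢ A (glueˢ B C g) h ≃ glueˢ (glueˢ A B (λ a b → h a (inj₁ b))) C k
glueˢ-assoc A B C g h k k-left k-mid = record { to = Sum.assocˡ ; from = Sum.assocʳ
  ; from∘to = λ { (inj₁ _) → refl ; (inj₂ (inj₁ _)) → refl ; (inj₂ (inj₂ _)) → refl }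
  ; to∘from = λ { (inj₁ (inj₁ _)) → refl ; (inj₁ (inj₂ _)) → refl ; (inj₂ _) → refl }
  ; label-pres = λ { (inj₁ _) → refl ; (inj₂ (inj₁ _)) → refl ; (inj₂ (inj₂ _)) → refl }
  ; adj-pres = λ { (inj₁ _) (inj₁ _) → refl
                 ; (inj₁ _) (inj₂ (inj₁ _)) → refl
                 ; (inj₁ a) (inj₂ (inj₂ c)) → k-left a c
                 ; (inj₂ (inj₁ _)) (inj₁ _) → refl
                 ; (inj₂ (inj₁ _)) (inj₂ (inj₁ _)) → refl
                 ; (inj₂ (inj₁ b)) (inj₂ (inj₂ c)) → k-mid b c
                 ; (inj₂ (inj₂ c)) (inj₁ a) → k-left a c
                 ; (inj₂ (inj₂ c)) (inj₂ (inj₁ b)) → k-mid b c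
                 ; (inj₂ (inj₂ _)) (inj₂ (inj₂ _)) → refl } }

emptyˢ : Structure
emptyˢ = structure ⊥ (λ ()) (λ ()) (λ ())

glueˢ-identityʳ : ∀ A f → glueˢ A emptyˢ f ≃ A
glueˢ-identityʳ A f = record { to = λ { (inj₁ a) → a } ; from = inj₁
  ; from∘to = λ { (inj₁ _) → refl } ; to∘from = λ _ → refl ; label-pres = λ { (inj₁ _) → refl }
  ; adj-pres = λ { (inj₁ _) (inj₁ _) → refl } }

glueˢ-identityˡ : ∀ A f → glueˢ emptyˢ A f ≃ A
glueˢ-identityˡ A f = record { to = λ { (inj₂ a) → a } ; from = inj₂
  ; from∘to = λ { (inj₂ _) → refl } ; to∘from = λ _ → refl ; label-pres = λ { (inj₂ _) → refl }
  ; adj-pres = λ { (inj₂ _) (inj₂ _) → refl } }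

⟦⟧-empty : ∀ G → n G ≡ 0 → ⟦ G ⟧ ≃ emptyˢ
⟦⟧-empty (mkGraph zero _ _) refl = record { to = λ () ; from = λ () ; from∘to = λ () ; to∘from = λ ()
  ; label-pres = λ () ; adj-pres = λ () }

⟦∅⟧ : ⟦ ∅ ⟧ ≃ emptyˢ
⟦∅⟧ = ⟦⟧-empty ∅ refl

substˢ-zero : ∀ e H → substˢ 0 e H ≃ emptyˢ
substˢ-zero e H = record { to = λ { (() , _) } ; from = λ () ; from∘to = λ { (() , _) } ; to∘from = λ ()
  ; label-pres = λ { (() , _) } ; adj-pres = λ { (() , _) } }

substˢ-cong : ∀ m (e e′ : Fin m → Fin m → Bool) (H H′ : Fin m → Structure) →
  (∀ i j → i ≢ j → e′ i j ≡ e i j) → (∀ i → H i ≃ H′ i) → substˢ m e H ≃ substˢ m e′ H′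
substˢ-cong m e e′ H H′ e-pres α = record
  { to = λ (i , v) → i , to (α i) v ; from = λ (i , v) → i , from (α i) v
  ; from∘to = λ (i , v) → cong (i ,_) (from∘to (α i) v) ; to∘from = λ (i , v) → cong (i ,_) (to∘from (α i) v)
  ; label-pres = λ (i , v) → label-pres (α i) v ; adj-pres = adj-pres′ }
  where
  adj-pres′ : ∀ x y → substAdj e′ H′ (proj₁ x , to (α (proj₁ x)) (proj₂ x)) (proj₁ y , to (α (proj₁ y)) (proj₂ y))
                      ≡ substAdj e H x y
  adj-pres′ (i , v) (j , w) with i ≟ j
  ... | yes refl = adj-pres (α i) v w
  ... | no i≢j   = e-pres i j i≢j

substˢ-suc : ∀ m (e : Fin (suc m) → Fin (suc m) → Bool) H → (∀ i j → e i j ≡ e j i) →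
  substˢ (suc m) e H ≃ glueˢ (H zero) (substˢ m (λ i j → e (suc i) (suc j)) (H ∘ suc)) (λ _ (j , _) → e zero (suc j))
substˢ-suc m e H sym-e = record { to = to′ ; from = from′
  ; from∘to = λ { (zero , _) → refl ; (suc _ , _) → refl }
  ; to∘from = λ { (inj₁ _) → refl ; (inj₂ _) → refl }
  ; label-pres = λ { (zero , _) → refl ; (suc _ , _) → refl } ; adj-pres = adj-pres′ }
  where
  to′ : Σ (Fin (suc m)) (Vertex ∘ H) → Vertex (H zero) ⊎ Σ (Fin m) (Vertex ∘ H ∘ suc)
  to′ (zero , v)  = inj₁ v
  to′ (suc i , v) = inj₂ (i , v)
  from′ : Vertex (H zero) ⊎ Σ (Fin m) (Vertex ∘ H ∘ suc) → Σ (Fin (suc m)) (Vertex ∘ H)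
  from′ (inj₁ v)       = zero , v
  from′ (inj₂ (i , v)) = suc i , v
  adj-pres′ : ∀ x y → glueAdj _ _ _ (to′ x) (to′ y) ≡ substAdj e H x y
  adj-pres′ (zero , v) (zero , w)   = refl
  adj-pres′ (zero , v) (suc j , w)  = refl
  adj-pres′ (suc i , v) (zero , w)  = sym-e zero (suc i)
  adj-pres′ (suc i , v) (suc j , w) with i ≟ j
  ... | yes refl = substAdj-same _ _ i v w
  ... | no i≢j   = substAdj-diff _ _ i j v w i≢j

bigTensor-≃ : ∀ m F → ⟦ bigTensor m F ⟧ ≃ substˢ m (λ _ _ → true) (⟦_⟧ ∘ F)
bigTensor-≃ zero F    = ⟦∅⟧ ⨾ ≃-sym (substˢ-zero _ _)
bigTensor-≃ (suc m) F = glue-≃ _ _ _ ⨾ glueˢ-cong ≃-refl (bigTensor-≃ m (F ∘ suc)) _ _ (λ _ _ → refl)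
                        ⨾ ≃-sym (substˢ-suc m _ _ (λ _ _ → refl))

bigPar-≃ : ∀ m F → ⟦ bigPar m F ⟧ ≃ substˢ m (λ _ _ → false) (⟦_⟧ ∘ F)
bigPar-≃ zero F    = ⟦∅⟧ ⨾ ≃-sym (substˢ-zero _ _)
bigPar-≃ (suc m) F = glue-≃ _ _ _ ⨾ glueˢ-cong ≃-refl (bigPar-≃ m (F ∘ suc)) _ _ (λ _ _ → refl)
                     ⨾ ≃-sym (substˢ-suc m _ _ (λ _ _ → refl))

glue-cong : ∀ {G G′ H H′} f f′ → (α : ⟦ G ⟧ ≃ ⟦ G′ ⟧) (β : ⟦ H ⟧ ≃ ⟦ H′ ⟧) →
  (∀ a b → f′ (to α a) (to β b) ≡ f a b) → ⟦ glue G H f ⟧ ≃ ⟦ glue G′ H′ f′ ⟧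
glue-cong f f′ α β f-pres = glue-≃ _ _ f ⨾ glueˢ-cong α β f f′ f-pres ⨾ ≃-sym (glue-≃ _ _ f′)

glue-swap : ∀ G H f → ⟦ glue G H f ⟧ ≃ ⟦ glue H G (λ b a → f a b) ⟧
glue-swap G H f = glue-≃ G H f ⨾ glueˢ-swap _ _ f ⨾ ≃-sym (glue-≃ H G _)

glue-∅ : ∀ G f → ⟦ glue G ∅ f ⟧ ≃ ⟦ G ⟧
glue-∅ G f = glue-≃ G ∅ f ⨾ glueˢ-cong ≃-refl ⟦∅⟧ _ (λ _ ()) (λ _ ()) ⨾ glueˢ-identityʳ ⟦ G ⟧ _

⊔-left-comm : ∀ A B C → ⟦ A ⊔ (B ⊔ C) ⟧ ≃ ⟦ B ⊔ (A ⊔ C) ⟧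
⊔-left-comm A B C =
  glue-≃ A (B ⊔ C) _ ⨾ glueˢ-cong ≃-refl (glue-≃ B C _) _ _ (λ _ _ → refl)
  ⨾ glueˢ-assoc ⟦ A ⟧ ⟦ B ⟧ ⟦ C ⟧ _ _ (λ _ _ → false) (λ _ _ → refl) (λ _ _ → refl)
  ⨾ glueˢ-cong (glueˢ-swap ⟦ A ⟧ ⟦ B ⟧ _) ≃-refl _ _ (λ { (inj₁ _) _ → refl ; (inj₂ _) _ → refl })
  ⨾ ≃-sym (glueˢ-assoc ⟦ B ⟧ ⟦ A ⟧ ⟦ C ⟧ _ _ (λ _ _ → false) (λ _ _ → refl) (λ _ _ → refl))
  ⨾ glueˢ-cong ≃-refl (≃-sym (glue-≃ A C _)) _ _ (λ _ _ → refl) ⨾ ≃-sym (glue-≃ B (A ⊔ C) _)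

-- Derivations and duality

infixr 4 _▷_

_▷_ : ∀ {S X Y Z} → Derivation S X Y → Derivation S Y Z → Derivation S X Z
done          ▷ e = e
iso φ d       ▷ e = iso φ (d ▷ e)
rule C R r d  ▷ e = rule C R r (d ▷ e)

by-≃ : ∀ {S X Y} → ⟦ X ⟧ ≃ ⟦ Y ⟧ → Derivation S X Y
by-≃ α = iso (≃⇒≅ α) done

plug-cong : ∀ C R {X X′} → ⟦ X ⟧ ≃ ⟦ X′ ⟧ → ⟦ plug C X R ⟧ ≃ ⟦ plug C X′ R ⟧
plug-cong C R α = glue-cong _ _ ≃-refl α (λ _ _ → refl)

plugRegion : (C C′ : Graph) → (Fin (n C) → Bool) → (Fin (n C′) → Bool) → Fin (n C + n C′) → Bool
plugRegion C C′ R R′ x = [ R , R′ ]′ (splitAt (n C) x)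

plug-assoc : ∀ C C′ R R′ X → ⟦ plug C (plug C′ X R′) R ⟧ ≃ ⟦ plug (plug C C′ R) X (plugRegion C C′ R R′) ⟧
plug-assoc C C′ R R′ X =
  glue-≃ _ _ _ ⨾ glueˢ-cong ≃-refl (glue-≃ _ _ _) _ (λ c _ → R c) (λ _ _ → refl)
  ⨾ glueˢ-assoc ⟦ C ⟧ ⟦ C′ ⟧ ⟦ X ⟧ _ _ (λ u _ → [ R , R′ ]′ u) (λ _ _ → refl) (λ _ _ → refl)
  ⨾ glueˢ-cong (≃-sym (glue-≃ _ _ _)) ≃-refl _ _ (λ u _ → cong [ R , R′ ]′ (Finₚ.splitAt-join (n C) (n C′) u))
  ⨾ ≃-sym (glue-≃ _ _ _)

inContext : ∀ {S X Y} C R → Derivation S X Y → Derivation S (plug C X R) (plug C Y R)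
inContext C R done = done
inContext C R (iso φ d) = iso (≃⇒≅ (plug-cong C R (≅⇒≃ φ))) (inContext C R d)
inContext C R (rule {X = X} {Y = Y} C′ R′ r d) =
  iso (≃⇒≅ (plug-assoc C C′ R R′ X))
      (rule (plug C C′ R) (plugRegion C C′ R R′) r
        (iso (≃⇒≅ (≃-sym (plug-assoc C C′ R R′ Y))) (inContext C R d)))

plug-∅ : ∀ X (R : Fin 0 → Bool) → ⟦ plug ∅ X R ⟧ ≃ ⟦ X ⟧
plug-∅ X R = glue-≃ ∅ X (λ i _ → R i) ⨾ glueˢ-cong ⟦∅⟧ ≃-refl _ (λ ()) (λ ()) ⨾ glueˢ-identityˡ ⟦ X ⟧ (λ ())

by-rule : ∀ {S X Y} → S X Y → Derivation S X Y
by-rule {X = X} {Y} r = iso (≃⇒≅ (≃-sym (plug-∅ X R))) (rule ∅ R r (by-≃ (plug-∅ Y R)))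
  where
  R : Fin 0 → Bool
  R ()

dualˢ : Structure → Structure
dualˢ S = structure (Vertex S) (decEq S) (dualAtom ∘ label S) (λ x y → not (adj S x y) ∧ not ⌊ decEq S x y ⌋)

E-dualG : ∀ G i j → E (dualG G) i j ≡ not (E G i j) ∧ not ⌊ i ≟ j ⌋
E-dualG G i j rewrite E-sym G j i = cong (_∧ not ⌊ i ≟ j ⌋) (Boolₚ.∨-idem (not (E G i j)))

E-dualG-≢ : ∀ G i j → i ≢ j → E (dualG G) i j ≡ not (E G i j)
E-dualG-≢ G i j i≢j = trans (E-dualG G i j) (trans (cong (λ b → not (E G i j) ∧ not b) (⌊⌋-false (i ≟ j) i≢j))
                                                 (Boolₚ.∧-identityʳ _))

dualG-≃ : ∀ G → ⟦ dualG G ⟧ ≃ dualˢ ⟦ G ⟧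
dualG-≃ G = record { to = λ x → x ; from = λ x → x ; from∘to = λ _ → refl ; to∘from = λ _ → refl
  ; label-pres = λ _ → refl ; adj-pres = λ i j → sym (E-dualG G i j) }

dualˢ-cong : ∀ {A B} → A ≃ B → dualˢ A ≃ dualˢ B
dualˢ-cong {A} {B} α = record { to = to α ; from = from α ; from∘to = from∘to α ; to∘from = to∘from α
  ; label-pres = λ x → cong dualAtom (label-pres α x)
  ; adj-pres = λ x y → cong₂ (λ a b → not a ∧ not b) (adj-pres α x y)
                             (⌊⌋-injective (decEq A) (decEq B) (to α) (from α) (from∘to α) x y) }

dualˢ-glue : ∀ A B f → dualˢ (glueˢ A B f) ≃ glueˢ (dualˢ A) (dualˢ B) (λ a b → not (f a b))
dualˢ-glue A B f = record { to = λ x → x ; from = λ x → x ; from∘to = λ _ → refl ; to∘from = λ _ → refl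
  ; label-pres = λ { (inj₁ _) → refl ; (inj₂ _) → refl } ; adj-pres = adj-pres′ }
  where
  _≟⊎_ : DecidableEquality (Vertex A ⊎ Vertex B)
  _≟⊎_ = decEq (glueˢ A B f)
  adj-pres′ : ∀ x y → glueAdj (dualˢ A) (dualˢ B) (λ a b → not (f a b)) x y ≡ not (glueAdj A B f x y) ∧ not ⌊ x ≟⊎ y ⌋
  adj-pres′ (inj₁ a) (inj₁ a′) = cong (λ b → not (adj A a a′) ∧ not b)
    (⌊⌋-⇔ (decEq A a a′) (inj₁ a ≟⊎ inj₁ a′) (cong inj₁) Sumₚ.inj₁-injective)
  adj-pres′ (inj₂ b) (inj₂ b′) = cong (λ c → not (adj B b b′) ∧ not c)
    (⌊⌋-⇔ (decEq B b b′) (inj₂ b ≟⊎ inj₂ b′) (cong inj₂) Sumₚ.inj₂-injective)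
  adj-pres′ (inj₁ _) (inj₂ _) = sym (Boolₚ.∧-identityʳ _)
  adj-pres′ (inj₂ _) (inj₁ _) = sym (Boolₚ.∧-identityʳ _)

dualˢ-subst : ∀ m e H → dualˢ (substˢ m e H) ≃ substˢ m (λ i j → not (e i j) ∧ not ⌊ i ≟ j ⌋) (dualˢ ∘ H)
dualˢ-subst m e H = record { to = λ x → x ; from = λ x → x ; from∘to = λ _ → refl ; to∘from = λ _ → refl
  ; label-pres = λ _ → refl ; adj-pres = adj-pres′ }
  where
  _≟Σ_ : DecidableEquality (Σ (Fin m) (Vertex ∘ H))
  _≟Σ_ = decEq (substˢ m e H)
  adj-pres′ : ∀ x y → substAdj _ (dualˢ ∘ H) x y ≡ not (substAdj e H x y) ∧ not ⌊ x ≟Σ y ⌋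
  adj-pres′ (i , v) (j , w) with i ≟ j
  ... | yes refl = cong (λ b → not (adj (H i) v w) ∧ not b)
                     (⌊⌋-⇔ (decEq (H i) v w) (map′ (cong (i ,_)) ,-injectiveʳ (decEq (H i) v w)) (cong (i ,_)) ,-injectiveʳ)
    where
    ,-injectiveʳ : ∀ {v w} → _≡_ {A = Σ (Fin m) (Vertex ∘ H)} (i , v) (i , w) → v ≡ w
    ,-injectiveʳ = Productₚ.,-injectiveʳ-UIP Fin-irrelevant
  ... | no i≢j   = cong (λ b → not (e i j) ∧ not b) (⌊⌋-false (i ≟ j) i≢j)

dual-cong : ∀ {X Y} → ⟦ X ⟧ ≃ ⟦ Y ⟧ → ⟦ dualG X ⟧ ≃ ⟦ dualG Y ⟧
dual-cong {X} {Y} α = dualG-≃ X ⨾ dualˢ-cong α ⨾ ≃-sym (dualG-≃ Y)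

dual-glue : ∀ G H f → ⟦ dualG (glue G H f) ⟧ ≃ ⟦ glue (dualG G) (dualG H) (λ a b → not (f a b)) ⟧
dual-glue G H f = dualG-≃ (glue G H f) ⨾ dualˢ-cong (glue-≃ G H f) ⨾ dualˢ-glue ⟦ G ⟧ ⟦ H ⟧ f
  ⨾ glueˢ-cong (≃-sym (dualG-≃ G)) (≃-sym (dualG-≃ H)) _ _ (λ _ _ → refl) ⨾ ≃-sym (glue-≃ _ _ _)

dual-subst : ∀ G H → ⟦ dualG (subst G H) ⟧ ≃ ⟦ subst (dualG G) (dualG ∘ H) ⟧
dual-subst G H = dualG-≃ (subst G H) ⨾ dualˢ-cong (subst-≃ G H) ⨾ dualˢ-subst (n G) (E G) (⟦_⟧ ∘ H)
  ⨾ substˢ-cong _ _ _ _ _ (λ i j _ → E-dualG G i j) (≃-sym ∘ dualG-≃ ∘ H) ⨾ ≃-sym (subst-≃ _ _)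

dualAtom-involutive : ∀ a → dualAtom (dualAtom a) ≡ a
dualAtom-involutive (v , b) = cong (v ,_) (Boolₚ.not-involutive b)

E-dualG-involutive : ∀ G i j → E (dualG (dualG G)) i j ≡ E G i j
E-dualG-involutive G i j = by-cases (i ≟ j)
  where
  by-cases : Dec (i ≡ j) → E (dualG (dualG G)) i j ≡ E G i j
  by-cases (yes refl) = trans (E-irrefl (dualG (dualG G)) i) (sym (E-irrefl G i))
  by-cases (no i≢j) rewrite E-dualG (dualG G) i j | E-dualG G i j | ⌊⌋-false (i ≟ j) i≢j =
    trans (Boolₚ.∧-identityʳ _) (trans (cong not (Boolₚ.∧-identityʳ _)) (Boolₚ.not-involutive _))

dualG-involutive : ∀ G → ⟦ dualG (dualG G) ⟧ ≃ ⟦ G ⟧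
dualG-involutive G = record { to = λ x → x ; from = λ x → x ; from∘to = λ _ → refl ; to∘from = λ _ → refl
  ; label-pres = λ i → sym (dualAtom-involutive (lab G i)) ; adj-pres = λ i j → sym (E-dualG-involutive G i j) }

dual-∅ : ⟦ dualG ∅ ⟧ ≃ ⟦ ∅ ⟧
dual-∅ = ⟦⟧-empty (dualG ∅) refl ⨾ ≃-sym ⟦∅⟧

single-≃ : ∀ {a b} → a ≡ b → ⟦ single a ⟧ ≃ ⟦ single b ⟧
single-≃ refl = ≃-refl

dual-single : ∀ a → ⟦ dualG (single a) ⟧ ≃ ⟦ single (dualAtom a) ⟧
dual-single a = record { to = λ i → i ; from = λ i → i ; from∘to = λ _ → refl ; to∘from = λ _ → refl
  ; label-pres = λ _ → refl ; adj-pres = λ { zero zero → refl } }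

subst-dualG-involutive : ∀ P H → ⟦ subst (dualG (dualG P)) H ⟧ ≃ ⟦ subst P H ⟧
subst-dualG-involutive P H =
  subst-≃ _ H ⨾ substˢ-cong _ _ _ _ _ (λ i j _ → sym (E-dualG-involutive P i j)) (λ _ → ≃-refl) ⨾ ≃-sym (subst-≃ P H)

dual-bigTensor : ∀ m F → ⟦ dualG (bigTensor m F) ⟧ ≃ ⟦ bigPar m (dualG ∘ F) ⟧
dual-bigTensor m F = dualG-≃ (bigTensor m F) ⨾ dualˢ-cong (bigTensor-≃ m F) ⨾ dualˢ-subst m _ (⟦_⟧ ∘ F)
  ⨾ substˢ-cong m _ _ _ _ (λ _ _ _ → refl) (≃-sym ∘ dualG-≃ ∘ F) ⨾ ≃-sym (bigPar-≃ m (dualG ∘ F))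

bigTensor-cong : ∀ m F F′ → (∀ i → ⟦ F i ⟧ ≃ ⟦ F′ i ⟧) → ⟦ bigTensor m F ⟧ ≃ ⟦ bigTensor m F′ ⟧
bigTensor-cong m F F′ α = bigTensor-≃ m F ⨾ substˢ-cong m _ _ _ _ (λ _ _ _ → refl) α ⨾ ≃-sym (bigTensor-≃ m F′)

bigPar-cong : ∀ m F F′ → (∀ i → ⟦ F i ⟧ ≃ ⟦ F′ i ⟧) → ⟦ bigPar m F ⟧ ≃ ⟦ bigPar m F′ ⟧
bigPar-cong m F F′ α = bigPar-≃ m F ⨾ substˢ-cong m _ _ _ _ (λ _ _ _ → refl) α ⨾ ≃-sym (bigPar-≃ m F′)

dual-ai↓ : ∀ a → Derivation SGS↑ (dualG (single (dualAtom a) ⊔ single a)) (dualG ∅)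
dual-ai↓ a =
  by-≃ (dual-glue (single (dualAtom a)) (single a) _
        ⨾ glue-cong {dualG (single (dualAtom a))} {single a} {dualG (single a)} {single (dualAtom a)} _ _
            (dual-single (dualAtom a) ⨾ single-≃ (dualAtom-involutive a)) (dual-single a) (λ _ _ → refl))
  ▷ by-rule (inj₁ (inst a))
  ▷ by-≃ (≃-sym dual-∅)

dual-ss↓ : ∀ B A S → (∃ λ i → S i ≡ true) → NonEmpty A →
           Derivation SGS↑ (dualG (B ⊔ A)) (dualG (plug B A S))
dual-ss↓ B A S (i , i∈S) A≠∅ =
  by-≃ (dual-glue B A _)
  ▷ by-rule (inj₂ (inj₁ (inst (dualG B) (dualG A) (not ∘ S) (i , cong not i∈S) A≠∅)))
  ▷ by-≃ (≃-sym (dual-glue B A (λ i _ → S i)))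

dual-p↓ : ∀ P → Prime P → 4 ≤ n P → ∀ M N → (∀ i → NonEmpty (M i)) →
          Derivation SGS↑ (dualG (subst (dualG P) M ⊔ subst P N)) (dualG (bigTensor (n P) (λ i → M i ⊔ N i)))
dual-p↓ P prime 4≤n M N M≠∅ =
  by-≃ (dual-glue (subst (dualG P) M) (subst P N) _
        ⨾ glue-cong {dualG (subst (dualG P) M)} {subst P (dualG ∘ M)} {dualG (subst P N)} {subst (dualG P) (dualG ∘ N)} _ _
            (dual-subst (dualG P) M ⨾ subst-dualG-involutive P (dualG ∘ M)) (dual-subst P N) (λ _ _ → refl))
  ▷ by-rule (inj₂ (inj₂ (inst P prime 4≤n (dualG ∘ M) (dualG ∘ N) M≠∅)))
  ▷ by-≃ (bigPar-cong (n P) _ _ (λ i → ≃-sym (dual-glue (M i) (N i) _)) ⨾ ≃-sym (dual-bigTensor (n P) _))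

dual-step : ∀ {X Y} → SGS↓ X Y → Derivation SGS↑ (dualG Y) (dualG X)
dual-step (inj₁ (inst a))                      = dual-ai↓ a
dual-step (inj₂ (inj₁ (inst B A S i A≠∅)))     = dual-ss↓ B A S i A≠∅
dual-step (inj₂ (inj₂ (inst P p 4≤n M N M≠∅))) = dual-p↓ P p 4≤n M N M≠∅

dual-derivation : ∀ {X Y} → Derivation SGS↓ X Y → Derivation SGS↑ (dualG Y) (dualG X)
dual-derivation done = done
dual-derivation (iso {G} {G′} φ d) = dual-derivation d ▷ by-≃ (dual-cong {G′} {G} (≃-sym (≅⇒≃ φ)))
dual-derivation (rule {X = X} {Y = Y} C R r d) =
  dual-derivation d
  ▷ by-≃ (dual-glue C Y _)
  ▷ inContext (dualG C) (not ∘ R) (dual-step r)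
  ▷ by-≃ (≃-sym (dual-glue C X (λ i _ → R i)))

GeneralisedP↓ : Graph → Set
GeneralisedP↓ A = ∀ (M N : Fin (n A) → Graph) → (∀ i → NonEmpty (M i)) →
  Derivation SGS↓ (bigTensor (n A) (λ i → M i ⊔ N i)) (subst (dualG A) M ⊔ subst A N)

-- Quotients by modules

record Enumeration (m : ℕ) (P : Fin m → Bool) : Set where
  field
    size        : ℕ
    embed       : Fin size → Fin m
    index       : ∀ i → P i ≡ true → Fin size
    embed-∈     : ∀ a → P (embed a) ≡ true
    embed∘index : ∀ i p → embed (index i p) ≡ i
    index∘embed : ∀ a p → index (embed a) p ≡ a
open Enumeration

enumerate-suc : ∀ m P → Enumeration m (P ∘ suc) → (b : Bool) → P zero ≡ b → Enumeration (suc m) P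
enumerate-suc m P En true P0 = record { size = suc (size En)
  ; embed = λ { zero → zero ; (suc a) → suc (embed En a) }
  ; index = λ { zero _ → zero ; (suc i) p → suc (index En i p) }
  ; embed-∈ = λ { zero → P0 ; (suc a) → embed-∈ En a }
  ; embed∘index = λ { zero _ → refl ; (suc i) p → cong suc (embed∘index En i p) }
  ; index∘embed = λ { zero _ → refl ; (suc a) p → cong suc (index∘embed En a p) } }
enumerate-suc m P En false P0 = record { size = size En
  ; embed = suc ∘ embed En
  ; index = λ { zero p → ⊥-elim (true≢false (trans (sym p) P0)) ; (suc i) p → index En i p }
  ; embed-∈ = embed-∈ En
  ; embed∘index = λ { zero p → ⊥-elim (true≢false (trans (sym p) P0)) ; (suc i) p → cong suc (embed∘index En i p) }
  ; index∘embed = index∘embed En }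

enumerate : ∀ m P → Enumeration m P
enumerate zero P = record { size = 0 ; embed = λ () ; index = λ () ; embed-∈ = λ ()
  ; embed∘index = λ () ; index∘embed = λ () }
enumerate (suc m) P = enumerate-suc m P (enumerate m (P ∘ suc)) (P zero) refl

embed-injective : ∀ {m P} (En : Enumeration m P) a b → embed En a ≡ embed En b → a ≡ b
embed-injective En a b eq =
  trans (sym (index∘embed En a (embed-∈ En a)))
        (trans (index-cong eq (embed-∈ En a) (embed-∈ En b)) (index∘embed En b (embed-∈ En b)))
  where
  index-cong : ∀ {i j} (i≡j : i ≡ j) p q → index En i p ≡ index En j q
  index-cong refl p q rewrite Bool-irrelevant p q = refl

size-+-complement : ∀ m P → size (enumerate m P) + size (enumerate m (not ∘ P)) ≡ m
size-+-complement zero P = refl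
size-+-complement (suc m) P = by-cases (P zero) refl
  where
  by-cases : ∀ b (P0 : P zero ≡ b) →
             size (enumerate-suc m P (enumerate m (P ∘ suc)) b P0)
             + size (enumerate-suc m (not ∘ P) (enumerate m (not ∘ P ∘ suc)) (not b) (cong not P0)) ≡ suc m
  by-cases true  _ = cong suc (size-+-complement m (P ∘ suc))
  by-cases false _ = trans (ℕₚ.+-suc _ _) (cong suc (size-+-complement m (P ∘ suc)))

module Partition (m : ℕ) (e : Fin m → Fin m → Bool) (H : Fin m → Structure) (sym-e : ∀ i j → e i j ≡ e j i)
                 (P : Fin m → Bool) where

  In  : Enumeration m P
  In  = enumerate m P
  Out : Enumeration m (not ∘ P)
  Out = enumerate m (not ∘ P)

  restrictˢ : ∀ {Q} → Enumeration m Q → Structure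
  restrictˢ En = substˢ (size En) (λ a b → e (embed En a) (embed En b)) (H ∘ embed En)

  partitioned : Structure
  partitioned = glueˢ (restrictˢ In) (restrictˢ Out) (λ (a , _) (b , _) → e (embed In a) (embed Out b))

  retag : ∀ {i j} → j ≡ i → Vertex (H i) → Vertex (H j)
  retag j≡i = transport (Vertex ∘ H) (sym j≡i)

  classify : ∀ i → Vertex (H i) → (b : Bool) → P i ≡ b → Vertex partitioned
  classify i v true  Pi = inj₁ (index In i Pi , retag (embed∘index In i Pi) v)
  classify i v false Pi = inj₂ (index Out i (cong not Pi) , retag (embed∘index Out i (cong not Pi)) v)

  unclassify : Vertex partitioned → Σ (Fin m) (Vertex ∘ H)
  unclassify (inj₁ (a , v)) = embed In a , v
  unclassify (inj₂ (a , v)) = embed Out a , v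

  ,-retag : ∀ {j i} (j≡i : j ≡ i) v → _≡_ {A = Σ (Fin m) (Vertex ∘ H)} (j , retag j≡i v) (i , v)
  ,-retag refl v = refl

  ,-retag-embed : ∀ {Q} (En : Enumeration m Q) {c a} → c ≡ a → (q : embed En c ≡ embed En a) → ∀ v →
                  _≡_ {A = Σ (Fin (size En)) (Vertex ∘ H ∘ embed En)} (c , retag q v) (a , v)
  ,-retag-embed En refl q v rewrite Fin-irrelevant q refl = refl

  unclassify∘classify : ∀ i v b Pi → unclassify (classify i v b Pi) ≡ (i , v)
  unclassify∘classify i v true  Pi = ,-retag (embed∘index In i Pi) v
  unclassify∘classify i v false Pi = ,-retag (embed∘index Out i (cong not Pi)) v

  classify-in : ∀ a v b Pi → classify (embed In a) v b Pi ≡ inj₁ (a , v)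
  classify-in a v true  Pi = cong inj₁ (,-retag-embed In (index∘embed In a Pi) (embed∘index In (embed In a) Pi) v)
  classify-in a v false Pi = ⊥-elim (true≢false (trans (sym (embed-∈ In a)) Pi))

  classify-out : ∀ a v b Pi → classify (embed Out a) v b Pi ≡ inj₂ (a , v)
  classify-out a v true  Pi = ⊥-elim (true≢false (trans (sym (embed-∈ Out a)) (cong not Pi)))
  classify-out a v false Pi =
    cong inj₂ (,-retag-embed Out (index∘embed Out a (cong not Pi)) (embed∘index Out (embed Out a) (cong not Pi)) v)

  label-retag : ∀ {j i} (j≡i : j ≡ i) v → label (H j) (retag j≡i v) ≡ label (H i) v
  label-retag refl v = refl

  label-classify : ∀ i v b Pi → label partitioned (classify i v b Pi) ≡ label (H i) v
  label-classify i v true  Pi = label-retag (embed∘index In i Pi) v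
  label-classify i v false Pi = label-retag (embed∘index Out i (cong not Pi)) v

  adj-retag : ∀ {Q} (En : Enumeration m Q) a b {i j} (q₁ : embed En a ≡ i) (q₂ : embed En b ≡ j) v w →
              adj (restrictˢ En) (a , retag q₁ v) (b , retag q₂ w) ≡ substAdj e H (i , v) (j , w)
  adj-retag En a b refl refl v w with a ≟ b
  ... | yes refl = sym (substAdj-same e H (embed En a) v w)
  ... | no a≢b   = sym (substAdj-diff e H (embed En a) (embed En b) v w (a≢b ∘ embed-injective En a b))

  different-sides : ∀ {i j} → P i ≡ true → P j ≡ false → i ≢ j
  different-sides Pi Pj refl = true≢false (trans (sym Pi) Pj)

  adj-classify : ∀ i v b₁ Pi j w b₂ Pj → adj partitioned (classify i v b₁ Pi) (classify j w b₂ Pj) ≡ substAdj e H (i , v) (j , w)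
  adj-classify i v true Pi j w true Pj =
    adj-retag In _ _ (embed∘index In i Pi) (embed∘index In j Pj) v w
  adj-classify i v false Pi j w false Pj =
    adj-retag Out _ _ (embed∘index Out i (cong not Pi)) (embed∘index Out j (cong not Pj)) v w
  adj-classify i v true Pi j w false Pj =
    trans (cong₂ e (embed∘index In i Pi) (embed∘index Out j (cong not Pj)))
          (sym (substAdj-diff e H i j v w (different-sides Pi Pj)))
  adj-classify i v false Pi j w true Pj =
    trans (cong₂ e (embed∘index In j Pj) (embed∘index Out i (cong not Pi)))
          (trans (sym-e j i) (sym (substAdj-diff e H i j v w (different-sides Pj Pi ∘ sym))))

  substˢ-partition : substˢ m e H ≃ partitioned
  substˢ-partition = record
    { to = λ (i , v) → classify i v (P i) refl ; from = unclassify
    ; from∘to = λ (i , v) → unclassify∘classify i v (P i) refl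
    ; to∘from = λ { (inj₁ (a , w)) → classify-in a w _ refl ; (inj₂ (a , w)) → classify-out a w _ refl }
    ; label-pres = λ (i , v) → label-classify i v (P i) refl
    ; adj-pres = λ (i , v) (j , w) → adj-classify i v (P i) refl j w (P j) refl }

dual-module : ∀ G X → IsModule G X → IsModule (dualG G) X
dual-module G X X-module v x y v∉X x∈X y∈X =
  trans (E-dualG G v x) (trans (cong₂ (λ a b → not a ∧ not b) (X-module v x y v∉X x∈X y∈X)
    (trans (⌊⌋-false (v ≟ x) (outside x∈X)) (sym (⌊⌋-false (v ≟ y) (outside y∈X))))) (sym (E-dualG G v y)))
  where
  outside : ∀ {z} → X z ≡ true → v ≢ z
  outside z∈X refl = true≢false (trans (sym z∈X) v∉X)

total-positive : ∀ m s (a : Fin m) → 0 < s a → 0 < total m s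
total-positive (suc m) s zero    p = ℕₚ.≤-trans p (ℕₚ.m≤m+n (s zero) _)
total-positive (suc m) s (suc a) p = ℕₚ.≤-trans (total-positive m (s ∘ suc) a p) (ℕₚ.m≤n+m _ (s zero))

-- Graphs on Fin m are given by raw data l r, so that the dual of mkGraph m l r is again of this form,
-- namely mkGraph m (lab (dualG _)) (rel (dualG _)).
module Quotient (m : ℕ) (X : Fin m → Bool) (x₀ : Fin m) (x₀∈X : X x₀ ≡ true) where

  In  : Enumeration m X
  In  = enumerate m X
  Out : Enumeration m (not ∘ X)
  Out = enumerate m (not ∘ X)

  restriction : (Fin m → Atom) → (Fin m → Fin m → Bool) → Graph
  restriction l r = mkGraph (size In) (l ∘ embed In) (λ a b → E (mkGraph m l r) (embed In a) (embed In b))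

  -- Vertex zero stands for the whole module X; vertex suc o for the vertex embed Out o outside it.
  quotient : (Fin m → Atom) → (Fin m → Fin m → Bool) → Graph
  quotient l r = mkGraph (suc (size Out)) label′ rel′
    where
    label′ : Fin (suc (size Out)) → Atom
    label′ zero    = l x₀
    label′ (suc o) = l (embed Out o)
    rel′ : Fin (suc (size Out)) → Fin (suc (size Out)) → Bool
    rel′ zero    (suc o)  = E (mkGraph m l r) x₀ (embed Out o)
    rel′ (suc o) (suc o′) = E (mkGraph m l r) (embed Out o) (embed Out o′)
    rel′ _       zero     = false

  blocks : Graph → (Fin m → Graph) → Fin (suc (size Out)) → Graph
  blocks Z M zero    = Z
  blocks Z M (suc o) = M (embed Out o)

  E-restriction : ∀ l r a b → E (restriction l r) a b ≡ E (mkGraph m l r) (embed In a) (embed In b)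
  E-restriction l r a b rewrite ⌊⌋-⇔ (a ≟ b) (embed In a ≟ embed In b) (cong (embed In)) (embed-injective In a b) =
    closure-of-simple ⟦ mkGraph m l r ⟧ (⟦⟧-simple (mkGraph m l r)) (embed In a) (embed In b)

  E-quotient-inner : ∀ l r o o′ → E (quotient l r) (suc o) (suc o′) ≡ E (mkGraph m l r) (embed Out o) (embed Out o′)
  E-quotient-inner l r o o′
    rewrite ⌊⌋-⇔ (suc o ≟ suc o′) (embed Out o ≟ embed Out o′) (cong (embed Out) ∘ Finₚ.suc-injective)
                 (cong suc ∘ embed-injective Out o o′) =
    closure-of-simple ⟦ mkGraph m l r ⟧ (⟦⟧-simple (mkGraph m l r)) (embed Out o) (embed Out o′)

  E-quotient-module : ∀ l r o → E (quotient l r) zero (suc o) ≡ E (mkGraph m l r) x₀ (embed Out o)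
  E-quotient-module l r o = trans (Boolₚ.∧-identityʳ _) (Boolₚ.∨-identityʳ _)

  embed-Out-∉ : ∀ o → X (embed Out o) ≡ false
  embed-Out-∉ o = Boolₚ.¬-not (λ p → true≢false (trans (sym (embed-∈ Out o)) (cong not p)))

  x₀≢embed-Out : ∀ o → x₀ ≢ embed Out o
  x₀≢embed-Out o x₀≡ = true≢false (trans (sym x₀∈X) (trans (cong X x₀≡) (embed-Out-∉ o)))

  -- Since X is a module, every vertex of X sees the outside vertex embed Out o exactly as x₀ does.
  subst-quotient : ∀ l r → IsModule (mkGraph m l r) X → ∀ M →
    ⟦ subst (quotient l r) (blocks (subst (restriction l r) (M ∘ embed In)) M) ⟧ ≃ ⟦ subst (mkGraph m l r) M ⟧
  subst-quotient l r X-module M =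
    subst-≃ Q B
    ⨾ substˢ-suc (size Out) (E Q) (⟦_⟧ ∘ B) (E-sym Q)
    ⨾ glueˢ-cong (subst-≃ (restriction l r) (M ∘ embed In)
                  ⨾ substˢ-cong (size In) _ _ _ _ (λ a b _ → sym (E-restriction l r a b)) (λ _ → ≃-refl))
                 (substˢ-cong (size Out) _ _ _ _ (λ o o′ _ → sym (E-quotient-inner l r o o′)) (λ _ → ≃-refl))
                 _ _ cross-edges
    ⨾ ≃-sym (Partition.substˢ-partition m (E G) (⟦_⟧ ∘ M) (E-sym G) X)
    ⨾ ≃-sym (subst-≃ G M)
    where
    G Q : Graph
    G = mkGraph m l r
    Q = quotient l r
    B : Fin (suc (size Out)) → Graph
    B = blocks (subst (restriction l r) (M ∘ embed In)) M
    cross-edges : ∀ v (p : Σ (Fin (size Out)) _) →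
      E G (embed In (proj₁ (decode (size In) (λ a → n (M (embed In a))) v))) (embed Out (proj₁ p))
      ≡ E Q zero (suc (proj₁ p))
    cross-edges v (o , _) =
      trans (E-sym G _ _)
        (trans (sym (X-module (embed Out o) x₀ _ (embed-Out-∉ o) x₀∈X (embed-∈ In _)))
          (trans (E-sym G _ _) (sym (E-quotient-module l r o))))

  E-restriction-dual : ∀ l r a b → a ≢ b →
    E (restriction (lab (dualG (mkGraph m l r))) (rel (dualG (mkGraph m l r)))) a b ≡ E (dualG (restriction l r)) a b
  E-restriction-dual l r a b a≢b =
    trans (E-restriction (lab (dualG (mkGraph m l r))) (rel (dualG (mkGraph m l r))) a b)
      (trans (E-dualG-≢ (mkGraph m l r) _ _ (a≢b ∘ embed-injective In a b))
        (trans (cong not (sym (E-restriction l r a b))) (sym (E-dualG-≢ (restriction l r) a b a≢b))))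

  E-quotient-dual : ∀ l r i j → i ≢ j →
    E (quotient (lab (dualG (mkGraph m l r))) (rel (dualG (mkGraph m l r)))) i j ≡ E (dualG (quotient l r)) i j
  E-quotient-dual l r i j i≢j = trans (E-dual-quotient i j i≢j) (sym (E-dualG-≢ Q i j i≢j))
    where
    G Q Q̄ : Graph
    G = mkGraph m l r
    Q = quotient l r
    Q̄ = quotient (lab (dualG G)) (rel (dualG G))
    E-dual-quotient : ∀ i j → i ≢ j → E Q̄ i j ≡ not (E Q i j)
    E-dual-quotient zero zero i≢i = ⊥-elim (i≢i refl)
    E-dual-quotient zero (suc o) _ =
      trans (E-quotient-module (lab (dualG G)) (rel (dualG G)) o)
        (trans (E-dualG-≢ G _ _ (x₀≢embed-Out o)) (cong not (sym (E-quotient-module l r o))))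
    E-dual-quotient (suc o) zero _ =
      trans (E-sym Q̄ (suc o) zero) (trans (E-dual-quotient zero (suc o) (λ ())) (cong not (E-sym Q zero (suc o))))
    E-dual-quotient (suc o) (suc o′) o≢o′ =
      trans (E-quotient-inner (lab (dualG G)) (rel (dualG G)) o o′)
        (trans (E-dualG-≢ G _ _ (o≢o′ ∘ cong suc ∘ embed-injective Out o o′)) (cong not (sym (E-quotient-inner l r o o′))))

  generalisedP↓-by-quotient : ∀ l r → IsModule (mkGraph m l r) X →
    GeneralisedP↓ (restriction l r) → GeneralisedP↓ (quotient l r) → GeneralisedP↓ (mkGraph m l r)
  generalisedP↓-by-quotient l r X-module IH-restriction IH-quotient M N M≠∅ =
    by-≃ regroup
    ▷ inContext Outside (λ _ → true) (IH-restriction (M ∘ embed In) (N ∘ embed In) (M≠∅ ∘ embed In))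
    ▷ by-≃ reorder
    ▷ IH-quotient M′ N′ M′≠∅
    ▷ by-≃ reassemble
    where
    G R Q : Graph
    G = mkGraph m l r
    R = restriction l r
    Q = quotient l r
    F : Fin m → Graph
    F i = M i ⊔ N i
    Outside Inside Inside′ : Graph
    Outside = bigTensor (size Out) (F ∘ embed Out)
    Inside  = bigTensor (size In) (F ∘ embed In)
    Inside′ = subst (dualG R) (M ∘ embed In) ⊔ subst R (N ∘ embed In)
    M′ N′ : Fin (suc (size Out)) → Graph
    M′ = blocks (subst (dualG R) (M ∘ embed In)) M
    N′ = blocks (subst R (N ∘ embed In)) N

    regroup : ⟦ bigTensor m F ⟧ ≃ ⟦ plug Outside Inside (λ _ → true) ⟧
    regroup = bigTensor-≃ m F ⨾ Partition.substˢ-partition m (λ _ _ → true) (⟦_⟧ ∘ F) (λ _ _ → refl) X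
      ⨾ glueˢ-swap _ _ _
      ⨾ glueˢ-cong (≃-sym (bigTensor-≃ _ (F ∘ embed Out))) (≃-sym (bigTensor-≃ _ (F ∘ embed In))) _ _ (λ _ _ → refl)
      ⨾ ≃-sym (glue-≃ Outside Inside _)

    reorder : ⟦ plug Outside Inside′ (λ _ → true) ⟧ ≃ ⟦ bigTensor (suc (size Out)) (λ j → M′ j ⊔ N′ j) ⟧
    reorder = glue-≃ Outside Inside′ _ ⨾ glueˢ-swap _ _ _ ⨾ ≃-sym (glue-≃ Inside′ Outside _)

    M′≠∅ : ∀ j → NonEmpty (M′ j)
    M′≠∅ zero    = total-positive (size In) (λ a → n (M (embed In a))) (index In x₀ x₀∈X) (M≠∅ _)
    M′≠∅ (suc o) = M≠∅ (embed Out o)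

    dual-block : ∀ j → ⟦ M′ j ⟧ ≃ ⟦ blocks (subst (restriction (lab (dualG G)) (rel (dualG G))) (M ∘ embed In)) M j ⟧
    dual-block zero    = subst-≃ (dualG R) _ ⨾ substˢ-cong _ _ _ _ _ (E-restriction-dual l r) (λ _ → ≃-refl)
                         ⨾ ≃-sym (subst-≃ _ _)
    dual-block (suc o) = ≃-refl

    reassemble : ⟦ subst (dualG Q) M′ ⊔ subst Q N′ ⟧ ≃ ⟦ subst (dualG G) M ⊔ subst G N ⟧
    reassemble = glue-cong _ _
      (subst-≃ (dualG Q) M′ ⨾ substˢ-cong _ _ _ _ _ (E-quotient-dual l r) dual-block ⨾ ≃-sym (subst-≃ _ _)
       ⨾ subst-quotient (lab (dualG G)) (rel (dualG G)) (dual-module G X X-module) M)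
      (subst-quotient l r X-module N) (λ _ _ → refl)

-- Small graphs and prime graphs

ss↓-unconstrained : ∀ B A S → Derivation SGS↓ (plug B A S) (B ⊔ A)
ss↓-unconstrained B A@(mkGraph zero _ _) S = by-≃ (glue-cong {B} {B} {A} {A} _ _ ≃-refl ≃-refl (λ _ ()))
ss↓-unconstrained B A@(mkGraph (suc _) _ _) S with Finₚ.any? (λ i → S i Bool.≟ true)
... | yes (i , i∈S) = by-rule (inj₂ (inj₁ (inst B A S (i , i∈S) (s≤s z≤n))))
... | no S≡∅        = by-≃ (glue-cong {B} {B} {A} {A} _ _ ≃-refl ≃-refl (λ i _ → sym (Boolₚ.¬-not (λ i∈S → S≡∅ (i , i∈S)))))

isInj₁ isInj₂ : ∀ {A B : Set} → A ⊎ B → Bool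
isInj₁ = [ (λ _ → true) , (λ _ → false) ]′
isInj₂ = not ∘ isInj₁

-- Two switches: N₀ leaves the tensor first, then N₁ leaves what remains of its factor.
switch² : ∀ M₀ N₀ M₁ N₁ → Derivation SGS↓ ((M₀ ⊔ N₀) ⊗ (M₁ ⊔ N₁)) ((M₀ ⊗ M₁) ⊔ (N₀ ⊔ N₁))
switch² M₀ N₀ M₁ N₁ =
  by-≃ extract-N₀
  ▷ ss↓-unconstrained (M₀ ⊗ (M₁ ⊔ N₁)) N₀ (isInj₂ ∘ splitAt (n M₀))
  ▷ by-≃ (glue-swap (M₀ ⊗ (M₁ ⊔ N₁)) N₀ _)
  ▷ inContext N₀ (λ _ → false) (by-≃ extract-N₁ ▷ ss↓-unconstrained (M₀ ⊗ M₁) N₁ (isInj₁ ∘ splitAt (n M₀)))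
  ▷ by-≃ (⊔-left-comm N₀ (M₀ ⊗ M₁) N₁)
  where
  ⊤⊤ ⊥⊥ : ∀ {A B : Set} → A → B → Bool
  ⊤⊤ _ _ = true
  ⊥⊥ _ _ = false
  A₀ B₀ Y : Structure
  A₀ = ⟦ M₀ ⟧
  B₀ = ⟦ N₀ ⟧
  Y  = glueˢ ⟦ M₁ ⟧ ⟦ N₁ ⟧ ⊥⊥
  extract-N₀ : ⟦ (M₀ ⊔ N₀) ⊗ (M₁ ⊔ N₁) ⟧ ≃ ⟦ plug (M₀ ⊗ (M₁ ⊔ N₁)) N₀ (isInj₂ ∘ splitAt (n M₀)) ⟧
  extract-N₀ =
    glue-≃ _ _ _ ⨾ glueˢ-cong (glue-≃ M₀ N₀ _) (glue-≃ M₁ N₁ _) _ ⊤⊤ (λ _ _ → refl)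
    ⨾ glueˢ-cong (glueˢ-swap A₀ B₀ ⊥⊥) ≃-refl _ ⊤⊤ (λ { (inj₁ _) _ → refl ; (inj₂ _) _ → refl })
    ⨾ ≃-sym (glueˢ-assoc B₀ A₀ Y ⊤⊤ (λ _ → isInj₂) ⊤⊤ (λ _ _ → refl) (λ _ _ → refl))
    ⨾ glueˢ-swap B₀ (glueˢ A₀ Y ⊤⊤) _
    ⨾ ≃-sym (glue-≃ _ N₀ _ ⨾ glueˢ-cong (glue-≃ M₀ (M₁ ⊔ N₁) _ ⨾ glueˢ-cong ≃-refl (glue-≃ M₁ N₁ _) _ ⊤⊤ (λ _ _ → refl))
                                          ≃-refl _ (λ u _ → isInj₂ u) (λ x _ → cong not (Sumₚ.[,]-map (splitAt (n M₀) x))))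
  extract-N₁ : ⟦ M₀ ⊗ (M₁ ⊔ N₁) ⟧ ≃ ⟦ plug (M₀ ⊗ M₁) N₁ (isInj₁ ∘ splitAt (n M₀)) ⟧
  extract-N₁ =
    glue-≃ _ _ _ ⨾ glueˢ-cong ≃-refl (glue-≃ M₁ N₁ _) _ ⊤⊤ (λ _ _ → refl)
    ⨾ glueˢ-assoc A₀ ⟦ M₁ ⟧ ⟦ N₁ ⟧ ⊥⊥ ⊤⊤ (λ u _ → isInj₁ u) (λ _ _ → refl) (λ _ _ → refl)
    ⨾ ≃-sym (glue-≃ _ N₁ _ ⨾ glueˢ-cong (glue-≃ M₀ M₁ _) ≃-refl _ (λ u _ → isInj₁ u) (λ _ _ → refl))

generalisedP↓-empty : ∀ l r → GeneralisedP↓ (mkGraph 0 l r)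
generalisedP↓-empty l r M N _ = by-≃ (⟦∅⟧ ⨾ ≃-sym (⟦⟧-empty (subst (dualG A) M ⊔ subst A N) refl))
  where
  A : Graph
  A = mkGraph 0 l r

subst-single-vertex : ∀ l r H → ⟦ subst (mkGraph 1 l r) H ⟧ ≃ ⟦ H zero ⟧
subst-single-vertex l r H =
  subst-≃ G H ⨾ substˢ-suc 0 (E G) _ (E-sym G)
  ⨾ glueˢ-cong ≃-refl (substˢ-zero _ _) _ (λ _ ()) (λ { _ (() , _) }) ⨾ glueˢ-identityʳ _ _
  where
  G : Graph
  G = mkGraph 1 l r

generalisedP↓-single-vertex : ∀ l r → GeneralisedP↓ (mkGraph 1 l r)
generalisedP↓-single-vertex l r M N _ =
  by-≃ (glue-∅ _ _ ⨾ glue-cong _ _ (≃-sym (subst-single-vertex _ _ M)) (≃-sym (subst-single-vertex l r N)) (λ _ _ → refl))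

subst-pair : ∀ l r H b → E (mkGraph 2 l r) zero (suc zero) ≡ b →
             ⟦ subst (mkGraph 2 l r) H ⟧ ≃ ⟦ glue (H zero) (H (suc zero)) (λ _ _ → b) ⟧
subst-pair l r H b E01≡b =
  subst-≃ G H ⨾ substˢ-suc 1 (E G) _ (E-sym G)
  ⨾ glueˢ-cong ≃-refl (substˢ-suc 0 _ _ (λ i j → E-sym G (suc i) (suc j))
                       ⨾ glueˢ-cong ≃-refl (substˢ-zero _ _) _ (λ _ ()) (λ { _ (() , _) }) ⨾ glueˢ-identityʳ _ _)
               _ (λ _ _ → b) (λ { _ (zero , _) → sym E01≡b })
  ⨾ ≃-sym (glue-≃ _ _ _)
  where
  G : Graph
  G = mkGraph 2 l r

generalisedP↓-edgeless-pair : ∀ l r → E (mkGraph 2 l r) zero (suc zero) ≡ false → ∀ M N →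
  Derivation SGS↓ (bigTensor 2 (λ i → M i ⊔ N i)) (subst (dualG (mkGraph 2 l r)) M ⊔ subst (mkGraph 2 l r) N)
generalisedP↓-edgeless-pair l r no-edge M N =
  by-≃ (glue-cong {M zero ⊔ N zero} {_} {bigTensor 1 (λ i → M (suc i) ⊔ N (suc i))} _ _ ≃-refl (glue-∅ _ _) (λ _ _ → refl))
  ▷ switch² (M zero) (N zero) (M (suc zero)) (N (suc zero))
  ▷ by-≃ (glue-cong _ _ (≃-sym (subst-pair _ _ M true dual-edge)) (≃-sym (subst-pair l r N false no-edge)) (λ _ _ → refl))
  where
  dual-edge : E (dualG (mkGraph 2 l r)) zero (suc zero) ≡ true
  dual-edge = trans (E-dualG-≢ (mkGraph 2 l r) zero (suc zero) (λ ())) (cong not no-edge)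

-- With an edge, the complement of the pair is edgeless; apply the edgeless case to it with M and N exchanged.
generalisedP↓-pair : ∀ l r → GeneralisedP↓ (mkGraph 2 l r)
generalisedP↓-pair l r M N _ = by-cases (E A zero (suc zero)) refl
  where
  A : Graph
  A = mkGraph 2 l r
  by-cases : ∀ b → E A zero (suc zero) ≡ b →
             Derivation SGS↓ (bigTensor 2 (λ i → M i ⊔ N i)) (subst (dualG A) M ⊔ subst A N)
  by-cases false no-edge = generalisedP↓-edgeless-pair l r no-edge M N
  by-cases true  edge    =
    by-≃ (bigTensor-cong 2 (λ i → M i ⊔ N i) (λ i → N i ⊔ M i) (λ i → glue-swap (M i) (N i) _))
    ▷ generalisedP↓-edgeless-pair (lab (dualG A)) (rel (dualG A))
        (trans (E-dualG-≢ A zero (suc zero) (λ ())) (cong not edge)) N M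
    ▷ by-≃ (glue-swap (subst (dualG (dualG A)) N) (subst (dualG A) M) _
            ⨾ glue-cong {subst (dualG A) M} {subst (dualG A) M} _ _ ≃-refl (subst-dualG-involutive A N) (λ _ _ → refl))

Trivial : ∀ {k} → (Fin k → Bool) → Set
Trivial X = (∀ x y → X x ≡ true → X y ≡ true → x ≡ y) ⊎ (∀ v → X v ≡ true)

TwoMembers : ∀ {k} → (Fin k → Bool) → Set
TwoMembers X = ∃ λ x → ∃ λ y → X x ≡ true × X y ≡ true × x ≢ y

NonMember : ∀ {k} → (Fin k → Bool) → Set
NonMember X = ∃ λ v → X v ≡ false

IsNontrivialModule : (G : Graph) → (Fin (n G) → Bool) → Set
IsNontrivialModule G X = IsModule G X × TwoMembers X × NonMember X

isModule? : ∀ G X → Dec (IsModule G X)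
isModule? G X = Finₚ.all? λ v → Finₚ.all? λ x → Finₚ.all? λ y →
  (X v Bool.≟ false) →-dec (X x Bool.≟ true) →-dec (X y Bool.≟ true) →-dec (E G v x Bool.≟ E G v y)

twoMembers? : ∀ {k} (X : Fin k → Bool) → Dec (TwoMembers X)
twoMembers? X = Finₚ.any? λ x → Finₚ.any? λ y → (X x Bool.≟ true) ×-dec (X y Bool.≟ true) ×-dec ¬? (x ≟ y)

nonMember? : ∀ {k} (X : Fin k → Bool) → Dec (NonMember X)
nonMember? X = Finₚ.any? λ v → X v Bool.≟ false

isNontrivialModule? : ∀ G X → Dec (IsNontrivialModule G X)
isNontrivialModule? G X = isModule? G X ×-dec twoMembers? X ×-dec nonMember? X

isNontrivialModule-resp : ∀ G {X Y} → (∀ i → X i ≡ Y i) → IsNontrivialModule G X → IsNontrivialModule G Y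
isNontrivialModule-resp G X≗Y (X-module , (x , y , x∈ , y∈ , x≢y) , (v , v∉)) =
  (λ v x y v∉ x∈ y∈ → X-module v x y (trans (X≗Y v) v∉) (trans (X≗Y x) x∈) (trans (X≗Y y) y∈))
  , (x , y , trans (sym (X≗Y x)) x∈ , trans (sym (X≗Y y)) y∈ , x≢y)
  , (v , trans (sym (X≗Y v)) v∉)

trivial-if-not-nontrivial : ∀ G X → IsModule G X → ¬ IsNontrivialModule G X → Trivial X
trivial-if-not-nontrivial G X X-module ¬nontrivial with twoMembers? X | nonMember? X
... | yes two | yes out = ⊥-elim (¬nontrivial (X-module , two , out))
... | no ¬two | _       = inj₁ λ x y x∈ y∈ → decidable-stable (x ≟ y) (λ x≢y → ¬two (x , y , x∈ , y∈ , x≢y))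
... | yes _   | no ¬out = inj₂ λ v → Boolₚ.¬-not (λ v∉ → ¬out (v , v∉))

nontrivialModule-or-trivial : ∀ G → (∃ λ X → IsNontrivialModule G X) ⊎ (∀ X → IsModule G X → Trivial X)
nontrivialModule-or-trivial G with anySubset? (isNontrivialModule? G ∘ Vec.lookup)
... | yes (p , nontrivial) = inj₁ (Vec.lookup p , nontrivial)
... | no ¬nontrivial       = inj₂ λ X X-module → trivial-if-not-nontrivial G X X-module λ nontrivial →
  ¬nontrivial (Vec.tabulate X , isNontrivialModule-resp G (sym ∘ Vecₚ.lookup∘tabulate X) nontrivial)

allBut : ∀ {k} → Fin k → Fin k → Bool
allBut k v = not ⌊ v ≟ k ⌋

allBut-false : ∀ {m} {k v : Fin m} → allBut k v ≡ false → v ≡ k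
allBut-false {k = k} {v} v∉ with v ≟ k
... | yes v≡k = v≡k
... | no _    = ⊥-elim (true≢false v∉)

allBut-true : ∀ {m} {k x : Fin m} → allBut k x ≡ true → x ≢ k
allBut-true {k = k} {x} x∈ with x ≟ k
... | yes _   = ⊥-elim (true≢false (sym x∈))
... | no x≢k  = x≢k

allBut-module : ∀ G k → (∀ x y → x ≢ k → y ≢ k → E G k x ≡ E G k y) → IsModule G (allBut k)
allBut-module G k alike v x y v∉ x∈ y∈ with allBut-false v∉
... | refl = alike x y (allBut-true x∈) (allBut-true y∈)

module ThreeVertices (l : Fin 3 → Atom) (r : Fin 3 → Fin 3 → Bool) where

  A : Graph
  A = mkGraph 3 l r

  alike₀ : E A zero (suc zero) ≡ E A zero (suc (suc zero)) → ∀ x y → x ≢ zero → y ≢ zero → E A zero x ≡ E A zero y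
  alike₀ e (suc zero)       (suc zero)       _ _ = refl
  alike₀ e (suc zero)       (suc (suc zero)) _ _ = e
  alike₀ e (suc (suc zero)) (suc zero)       _ _ = sym e
  alike₀ e (suc (suc zero)) (suc (suc zero)) _ _ = refl
  alike₀ e zero             _                x≢0 _ = ⊥-elim (x≢0 refl)
  alike₀ e _                zero             _ y≢0 = ⊥-elim (y≢0 refl)

  alike₁ : E A (suc zero) zero ≡ E A (suc zero) (suc (suc zero)) →
           ∀ x y → x ≢ suc zero → y ≢ suc zero → E A (suc zero) x ≡ E A (suc zero) y
  alike₁ e zero             zero             _ _ = refl
  alike₁ e zero             (suc (suc zero)) _ _ = e
  alike₁ e (suc (suc zero)) zero             _ _ = sym e
  alike₁ e (suc (suc zero)) (suc (suc zero)) _ _ = refl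
  alike₁ e (suc zero)       _                x≢1 _ = ⊥-elim (x≢1 refl)
  alike₁ e _                (suc zero)       _ y≢1 = ⊥-elim (y≢1 refl)

  alike₂ : E A (suc (suc zero)) zero ≡ E A (suc (suc zero)) (suc zero) →
           ∀ x y → x ≢ suc (suc zero) → y ≢ suc (suc zero) → E A (suc (suc zero)) x ≡ E A (suc (suc zero)) y
  alike₂ e zero             zero             _ _ = refl
  alike₂ e zero             (suc zero)       _ _ = e
  alike₂ e (suc zero)       zero             _ _ = sym e
  alike₂ e (suc zero)       (suc zero)       _ _ = refl
  alike₂ e (suc (suc zero)) _                x≢2 _ = ⊥-elim (x≢2 refl)
  alike₂ e _                (suc (suc zero)) _ y≢2 = ⊥-elim (y≢2 refl)

  allBut-nontrivial : ∀ (k : Fin 3) → ¬ Trivial (allBut k)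
  allBut-nontrivial k (inj₂ all∈) = true≢false (trans (sym (all∈ k)) (cong not (⌊⌋-true (k ≟ k) refl)))
  allBut-nontrivial zero             (inj₁ one) = Finₚ.0≢1+n (Finₚ.suc-injective (one (suc zero) (suc (suc zero)) refl refl))
  allBut-nontrivial (suc zero)       (inj₁ one) = Finₚ.0≢1+n (one zero (suc (suc zero)) refl refl)
  allBut-nontrivial (suc (suc zero)) (inj₁ one) = Finₚ.0≢1+n (one zero (suc zero) refl refl)

  -- Some vertex sees the other two alike: if vertex 0 and vertex 1 do not, then E 02 ≠ E 01 ≠ E 12 forces E 02 = E 12.
  not-prime : ¬ (∀ X → IsModule A X → Trivial X)
  not-prime all-trivial with E A zero (suc zero) Bool.≟ E A zero (suc (suc zero))
                           | E A (suc zero) zero Bool.≟ E A (suc zero) (suc (suc zero))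
  ... | yes e | _ = allBut-nontrivial zero (all-trivial _ (allBut-module A zero (alike₀ e)))
  ... | no _ | yes e = allBut-nontrivial (suc zero) (all-trivial _ (allBut-module A (suc zero) (alike₁ e)))
  ... | no ¬e₀ | no ¬e₁ = allBut-nontrivial (suc (suc zero)) (all-trivial _ (allBut-module A (suc (suc zero)) (alike₂ e₂)))
    where
    e₂ : E A (suc (suc zero)) zero ≡ E A (suc (suc zero)) (suc zero)
    e₂ = trans (E-sym A _ _) (trans (Boolₚ.¬-not (¬e₀ ∘ sym))
           (trans (cong not (sym (E-sym A (suc zero) zero))) (trans (sym (Boolₚ.¬-not (¬e₁ ∘ sym))) (E-sym A _ _))))

generalisedP↓-without-nontrivial-module : ∀ m l r → (∀ X → IsModule (mkGraph (3 + m) l r) X → Trivial X) →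
                                          GeneralisedP↓ (mkGraph (3 + m) l r)
generalisedP↓-without-nontrivial-module zero    l r all-trivial = ⊥-elim (ThreeVertices.not-prime l r all-trivial)
generalisedP↓-without-nontrivial-module (suc m) l r all-trivial M N M≠∅ =
  by-rule (inj₂ (inj₂ (inst (mkGraph (4 + m) l r) (s≤s (s≤s z≤n) , all-trivial) (s≤s (s≤s (s≤s (s≤s z≤n)))) M N M≠∅)))

distinct⇒2≤ : ∀ {k} (a b : Fin k) → a ≢ b → 2 ≤ k
distinct⇒2≤ {suc zero}    zero zero a≢b = ⊥-elim (a≢b refl)
distinct⇒2≤ {suc (suc _)} _    _    _   = s≤s (s≤s z≤n)

inhabited⇒positive : ∀ {k} → Fin k → 0 < k
inhabited⇒positive zero    = s≤s z≤n
inhabited⇒positive (suc _) = s≤s z≤n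

module-parts-smaller : ∀ m X → TwoMembers X → NonMember X →
  size (enumerate m X) < m × suc (size (enumerate m (not ∘ X))) < m
module-parts-smaller m X (x , y , x∈ , y∈ , x≢y) (v , v∉) =
  transport (size In <_) partition (ℕₚ.m<m+n (size In) (inhabited⇒positive (index Out v (cong not v∉))))
  , transport (suc (size Out) <_) partition (ℕₚ.+-monoˡ-≤ (size Out) (distinct⇒2≤ _ _ distinct-indices))
  where
  In  : Enumeration m X
  In  = enumerate m X
  Out : Enumeration m (not ∘ X)
  Out = enumerate m (not ∘ X)
  partition : size In + size Out ≡ m
  partition = size-+-complement m X
  distinct-indices : index In x x∈ ≢ index In y y∈
  distinct-indices eq = x≢y (trans (sym (embed∘index In x x∈)) (trans (cong (embed In) eq) (embed∘index In y y∈)))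

generalisedP↓-bounded : ∀ b A → n A ≤ b → GeneralisedP↓ A
generalisedP↓-bounded _ (mkGraph 0 l r) _ = generalisedP↓-empty l r
generalisedP↓-bounded _ (mkGraph 1 l r) _ = generalisedP↓-single-vertex l r
generalisedP↓-bounded _ (mkGraph 2 l r) _ = generalisedP↓-pair l r
generalisedP↓-bounded zero (mkGraph (suc (suc (suc _))) _ _) ()
generalisedP↓-bounded (suc b) A@(mkGraph (suc (suc (suc m))) l r) A≤ with nontrivialModule-or-trivial A
... | inj₂ all-trivial = generalisedP↓-without-nontrivial-module m l r all-trivial
... | inj₁ (X , X-module , two@(x , _ , x∈ , _) , out) =
  generalisedP↓-by-quotient l r X-module (generalisedP↓-bounded b _ (shrink (proj₁ smaller)))
                                         (generalisedP↓-bounded b _ (shrink (proj₂ smaller)))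
  where
  open Quotient (n A) X x x∈
  shrink : ∀ {k} → k < n A → k ≤ b
  shrink k< = ℕₚ.≤-pred (ℕₚ.<-≤-trans k< A≤)
  smaller : size In < n A × suc (size Out) < n A
  smaller = module-parts-smaller (n A) X two out

generalisedP↓ : ∀ A → GeneralisedP↓ A
generalisedP↓ A = generalisedP↓-bounded (n A) A ℕₚ.≤-refl

tensor-of-axioms : ∀ m (a : Fin m → Atom) → Derivation SGS↓ ∅ (bigTensor m (λ i → single (dualAtom (a i)) ⊔ single (a i)))
tensor-of-axioms zero    a = done
tensor-of-axioms (suc m) a =
  tensor-of-axioms m (a ∘ suc)
  ▷ by-≃ (≃-sym (glue-∅ T _))
  ▷ inContext T (λ _ → true) (by-rule (inj₁ (inst (a zero))))
  ▷ by-≃ (glue-swap T (single (dualAtom (a zero)) ⊔ single (a zero)) _)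
  where
  T : Graph
  T = bigTensor m (λ i → single (dualAtom (a (suc i))) ⊔ single (a (suc i)))

subst-singletons : ∀ G → ⟦ subst G (single ∘ lab G) ⟧ ≃ ⟦ G ⟧
subst-singletons G = subst-≃ G _ ⨾ record { to = proj₁ ; from = (_, zero)
  ; from∘to = λ { (_ , zero) → refl } ; to∘from = λ _ → refl
  ; label-pres = λ { (_ , zero) → refl } ; adj-pres = adj-pres′ }
  where
  adj-pres′ : ∀ x y → E G (proj₁ x) (proj₁ y) ≡ substAdj (E G) (⟦_⟧ ∘ single ∘ lab G) x y
  adj-pres′ (i , zero) (j , zero) with i ≟ j
  ... | yes refl = Boolₚ.∧-zeroʳ _
  ... | no i≢j   = cong (λ b → (rel G i j ∨ rel G j i) ∧ not b) (sym (⌊⌋-false (i ≟ j) i≢j))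

i↓-derivation : ∀ A → Derivation SGS↓ ∅ (dualG A ⊔ A)
i↓-derivation A =
  tensor-of-axioms (n A) (lab A)
  ▷ generalisedP↓ A (single ∘ lab (dualG A)) (single ∘ lab A) (λ _ → s≤s z≤n)
  ▷ by-≃ (glue-cong _ _ (subst-singletons (dualG A)) (subst-singletons A) (λ _ _ → refl))

i↑-derivation : ∀ A → Derivation SGS↑ (A ⊗ dualG A) ∅
i↑-derivation A =
  by-≃ (≃-sym (dual-glue (dualG A) A _ ⨾ glue-cong _ _ (dualG-involutive A) ≃-refl (λ _ _ → refl)))
  ▷ dual-derivation (i↓-derivation A)
  ▷ by-≃ dual-∅

corollary5p2 : Derivable i↓ SGS↓ × Derivable i↑ SGS↑
corollary5p2 = (λ { _ _ (inst A) → i↓-derivation A })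
             , (λ { _ _ (inst A) → i↑-derivation A })
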